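{- Let $D_{n,d}$ be the balanced double broom with $2 \leq d \leq n-1$. Then $$ T_{\mathrm{bestmeet}}(D_{n,d}) = \begin{cases} \frac{1}{2} \left((d-2) n -d^2 +3 d-2 \right) +\frac{d^3-6 d^2+11 d-6}{6 (n-1)} & \text{if $n$ odd and $d$ odd,} \\ \frac{1}{2} \left( (d-2) n -d^2 +3 d - 1 \right) +\frac{d^3-6 d^2+8 d}{6(n-1)} & \text{if $n$ odd and $d$ even,} \\ \frac{1}{2} \left( (d-2) n - d^2 + 3 d \right) +\frac{d^3-6 d^2+8 d}{6 (n-1)} & \text{if $n$ even and $d$ odd,} \\ \frac{1}{2}\left( (d-2) n- d^2 + 3 d - 1 \right) +\frac{d^3-6 d^2+11 d-6}{6 (n-1)} & \text{if $n$ even and $d$ even.} \\ \end{cases} $$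
   Context: For a connected graph $G=(V,E)$, $H(u,v)$ is the expected number of steps for the simple random walk (moving to a uniformly random neighbor at each step) started at $u$ to reach $v$, with $H(u,u)=0$; $\pi_v=\deg(v)/2|E|$; $H(\pi,v)=\sum_{u}\pi_uH(u,v)$; and $T_{\mathrm{bestmeet}}(G)=\min_{v\in V}H(\pi,v)$. The balanced double broom $D_{n,d}$ ($d\ge 2$) is the tree consisting of a path $v_1,\ldots,v_{d-1}$ together with $\ell=\lfloor (n-d+1)/2\rfloor$ leaves adjacent to $v_1$ and $r=\lceil (n-d+1)/2\rceil$ leaves adjacent to $v_{d-1}$ (when $d=2$, $v_1=v_{d-1}$ and the tree is the star on $n$ vertices). -}

module Defs where

open import Data.Bool using (Bool; true; false; _∧_; _∨_; if_then_else_)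
open import Data.Nat as ℕ using (ℕ; zero; suc; _∸_; _≡ᵇ_; _<ᵇ_; _%_)
import Data.Nat.DivMod
open import Data.Fin using (Fin; toℕ)
open import Data.Integer using (ℤ; +_)
open import Data.Rational using (ℚ; 0ℚ; 1ℚ; _+_; _*_; _-_; _/_; _≤_)
open import Data.Product using (Σ; _×_; ∃)
open import Relation.Binary.PropositionalEquality using (_≡_; _≢_)

sumFin : (n : ℕ) → (Fin n → ℚ) → ℚ
sumFin zero    f = 0ℚ
sumFin (suc n) f = f Fin.zero + sumFin n (λ i → f (Fin.suc i))
  where import Data.Fin as Fin

sumFinℕ : (n : ℕ) → (Fin n → ℕ) → ℕ
sumFinℕ zero    f = 0
sumFinℕ (suc n) f = f Fin.zero ℕ.+ sumFinℕ n (λ i → f (Fin.suc i))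
  where import Data.Fin as Fin

Adj : ℕ → Set
Adj n = Fin n → Fin n → Bool

ind : Bool → ℕ
ind true  = 1
ind false = 0

deg : {n : ℕ} → Adj n → Fin n → ℕ
deg {n} G u = sumFinℕ n (λ w → ind (G u w))

twoE : {n : ℕ} → Adj n → ℕ
twoE {n} G = sumFinℕ n (deg G)

ℕ→ℚ : ℕ → ℚ
ℕ→ℚ k = (+ k) / 1

π : {n : ℕ} (G : Adj n) → .{{_ : ℕ.NonZero (twoE G)}} → Fin n → ℚ
π G u = (+ deg G u) / twoE G

-- H is the hitting-time function of the simple random walk on G:
-- H(v,v) = 0, and for u ≠ v, H(u,v) = 1 + (1/deg u) Σ_{w ~ u} H(w,v)
-- (first-step equations, written multiplied through by deg u).
IsHittingTime : {n : ℕ} → Adj n → (Fin n → Fin n → ℚ) → Set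
IsHittingTime {n} G H =
  ((v : Fin n) → H v v ≡ 0ℚ) ×
  ((u v : Fin n) → u ≢ v →
     ℕ→ℚ (deg G u) * H u v
       ≡ ℕ→ℚ (deg G u) + sumFin n (λ w → ℕ→ℚ (ind (G u w)) * H w v))

Hπ : {n : ℕ} (G : Adj n) → .{{_ : ℕ.NonZero (twoE G)}} →
     (Fin n → Fin n → ℚ) → Fin n → ℚ
Hπ {n} G H v = sumFin n (λ u → π G u * H u v)

IsBestMeet : {n : ℕ} (G : Adj n) → .{{_ : ℕ.NonZero (twoE G)}} →
             (Fin n → Fin n → ℚ) → ℚ → Set
IsBestMeet {n} G H t =
  (∃ λ (v : Fin n) → Hπ G H v ≡ t) × ((v : Fin n) → t ≤ Hπ G H v)

-- Vertex i (as a natural number):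
--   0 .. d-2            : path v_1 .. v_{d-1}
--   d-1 .. d-2+ℓ        : ℓ leaves attached to v_1 (vertex 0)
--   d-1+ℓ .. n-1        : r leaves attached to v_{d-1} (vertex d-2)
-- with ℓ = ⌊(n-d+1)/2⌋ and r = n-(d-1)-ℓ = ⌈(n-d+1)/2⌉.
broomℓ : ℕ → ℕ → ℕ
broomℓ n d = (n ∸ (d ∸ 1)) ℕ./ 2

broomDir : ℕ → ℕ → ℕ → ℕ → Bool
broomDir n d i j =
  ((suc i ≡ᵇ j) ∧ (j <ᵇ (d ∸ 1)))
  ∨ ((i ≡ᵇ 0) ∧ ((d ∸ 1 <ᵇ suc j) ∧ (j <ᵇ (d ∸ 1) ℕ.+ broomℓ n d)))
  ∨ ((i ≡ᵇ (d ∸ 2)) ∧ (((d ∸ 1) ℕ.+ broomℓ n d) <ᵇ suc j))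

DoubleBroom : (n d : ℕ) → Adj n
DoubleBroom n d u v = broomDir n d (toℕ u) (toℕ v) ∨ broomDir n d (toℕ v) (toℕ u)

-- the closed-form value; n ≥ 3 in the theorem, so n = suc (suc k) and n-1 = suc k
formula : ℕ → ℕ → ℚ
formula zero          d = 0ℚ
formula (suc zero)    d = 0ℚ
formula (suc (suc k)) d =
  half * (((D - 2q) * N) - (D * D) + (3q * D) - c)
    + ((D * D * D) - (6q * D * D) + (e * D) - f) * ((+ 1) / (6 ℕ.* suc k))
  where
    N = ℕ→ℚ (suc (suc k))
    D = ℕ→ℚ d
    half = (+ 1) / 2
    2q = ℕ→ℚ 2
    3q = ℕ→ℚ 3
    6q = ℕ→ℚ 6
    nOdd = (suc (suc k) % 2) ≡ᵇ 1
    dOdd = (d % 2) ≡ᵇ 1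
    c = if nOdd then (if dOdd then ℕ→ℚ 2 else ℕ→ℚ 1)
                else (if dOdd then 0ℚ else ℕ→ℚ 1)
    e = if nOdd then (if dOdd then ℕ→ℚ 11 else ℕ→ℚ 8)
                else (if dOdd then ℕ→ℚ 8 else ℕ→ℚ 11)
    f = if nOdd then (if dOdd then ℕ→ℚ 6 else 0ℚ)
                else (if dOdd then 0ℚ else ℕ→ℚ 6)

-- On a tree, the expected time to cross an edge towards the target is the volume (sum of degrees) of the part
-- being left.  Solving the first-step equations vertex by vertex therefore makes H(·, v) a quadratic profile
-- along the path of the broom, each leaf lying one step above its neighbour.  Summing against the degrees gives
-- 2|E|·H(π, v) = Σ_u deg(u)·H(u, v) in closed form: for the path vertex at position t it is a convex quadratic
-- in t, minimised at t = ⌊(d − 2 + δ)/2⌋ with δ = r − ℓ, while a leaf target exceeds its neighbour by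
-- 2m(2m − 2), m = n − 1 edges.  The value at the minimiser, split by the parities of n and d, is the formula.
module Submission where

open import Defs
open import Level using (0ℓ)
open import Algebra.Bundles using (CommutativeRing)
open import Data.Nat as ℕ using (ℕ; zero; suc; _∸_; NonZero)
import Data.Nat.Properties as ℕ
import Data.Nat.DivMod as ℕ
open import Data.Integer as ℤ using (ℤ)
import Data.Integer.Properties as ℤ
import Data.Rational as ℚ
import Data.Rational.Properties as ℚ
open import Data.Rational.Solver using (module +-*-Solver)
open import Data.Rational.Unnormalised as ℚᵘ using (mkℚᵘ; *≡*)
import Data.Rational.Unnormalised.Properties as ℚᵘ
open import Data.Nat.Coprimality using (1-coprimeTo) renaming (sym to coprime-sym)
open import Data.Bool using (Bool; true; false; T; _∧_; _∨_; if_then_else_)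
open import Data.Bool.Properties using (T-≡; ∧-comm; ∧-zeroʳ; ∧-identityʳ)
open import Data.Sum using (_⊎_; inj₁; inj₂; [_,_])
import Data.Sum
open import Data.Product using (_×_; _,_; proj₁; proj₂)
open import Data.Fin using (Fin; toℕ)
open import Function.Base using (_∘_)
open import Function.Bundles using (Equivalence)
open import Relation.Nullary using (¬_; Dec; yes; no)
import Data.Fin as Fin
import Data.Fin.Properties as Fin
open import Data.Empty using (⊥-elim)
open import Relation.Binary.PropositionalEquality
  using (_≡_; _≢_; refl; sym; trans; cong; cong₂; subst; subst₂; module ≡-Reasoning)

module RangeSum (R : CommutativeRing 0ℓ 0ℓ) where
  open CommutativeRing R
    using (Carrier; _≈_; _+_; _*_; 0#; +-cong; +-congˡ; +-assoc; +-identityˡ; +-identityʳ;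
           zeroʳ; distribˡ; setoid; +-commutativeSemigroup)
    renaming (refl to ≈-refl; sym to ≈-sym; trans to ≈-trans; reflexive to ≈-reflexive)
  open import Algebra.Properties.CommutativeSemigroup +-commutativeSemigroup using (interchange)
  open import Relation.Binary.Reasoning.Setoid setoid

  sumFrom : ℕ → ℕ → (ℕ → Carrier) → Carrier
  sumFrom s zero    f = 0#
  sumFrom s (suc k) f = f s + sumFrom (suc s) k f

  sumFrom-cong : ∀ s k {f g : ℕ → Carrier} → (∀ j → s ℕ.≤ j → j ℕ.< s ℕ.+ k → f j ≈ g j) →
                 sumFrom s k f ≈ sumFrom s k g
  sumFrom-cong s zero    f≈g = ≈-refl
  sumFrom-cong s (suc k) f≈g = +-cong (f≈g s ℕ.≤-refl (ℕ.m<m+n s ℕ.z<s))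
    (sumFrom-cong (suc s) k λ j s<j j<s+k →
      f≈g j (ℕ.<⇒≤ s<j) (ℕ.<-≤-trans j<s+k (ℕ.≤-reflexive (sym (ℕ.+-suc s k)))))

  sumFrom-split : ∀ s a b f → sumFrom s (a ℕ.+ b) f ≈ sumFrom s a f + sumFrom (s ℕ.+ a) b f
  sumFrom-split s zero    b f = begin
    sumFrom s b f              ≡⟨ cong (λ s′ → sumFrom s′ b f) (sym (ℕ.+-identityʳ s)) ⟩
    sumFrom (s ℕ.+ 0) b f      ≈⟨ ≈-sym (+-identityˡ _) ⟩
    0# + sumFrom (s ℕ.+ 0) b f ∎
  sumFrom-split s (suc a) b f = begin
    f s + sumFrom (suc s) (a ℕ.+ b) f                        ≈⟨ +-congˡ (sumFrom-split (suc s) a b f) ⟩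
    f s + (sumFrom (suc s) a f + sumFrom (suc s ℕ.+ a) b f)  ≈⟨ ≈-sym (+-assoc _ _ _) ⟩
    f s + sumFrom (suc s) a f + sumFrom (suc s ℕ.+ a) b f
      ≡⟨ cong (λ s′ → f s + sumFrom (suc s) a f + sumFrom s′ b f)
        (sym (ℕ.+-suc s a)) ⟩
    f s + sumFrom (suc s) a f + sumFrom (s ℕ.+ suc a) b f    ∎

  sumFrom-last : ∀ s k f → sumFrom s (suc k) f ≈ sumFrom s k f + f (s ℕ.+ k)
  sumFrom-last s k f = begin
    sumFrom s (suc k) f                  ≡⟨ cong (λ k′ → sumFrom s k′ f) (ℕ.+-comm 1 k) ⟩
    sumFrom s (k ℕ.+ 1) f                ≈⟨ sumFrom-split s k 1 f ⟩
    sumFrom s k f + (f (s ℕ.+ k) + 0#)   ≈⟨ +-congˡ (+-identityʳ _) ⟩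
    sumFrom s k f + f (s ℕ.+ k)          ∎

  sumFrom-shift : ∀ s k f → sumFrom s k f ≈ sumFrom 0 k (λ j → f (s ℕ.+ j))
  sumFrom-shift s zero    f = ≈-refl
  sumFrom-shift s (suc k) f = +-cong (≈-reflexive (cong f (sym (ℕ.+-identityʳ s)))) (begin
    sumFrom (suc s) k f                         ≈⟨ sumFrom-shift (suc s) k f ⟩
    sumFrom 0 k (λ j → f (suc s ℕ.+ j))
      ≈⟨ sumFrom-cong 0 k (λ j _ _ → ≈-reflexive (cong f (sym (ℕ.+-suc s j)))) ⟩
    sumFrom 0 k (λ j → f (s ℕ.+ suc j))         ≈⟨ ≈-sym (sumFrom-shift 1 k (λ j → f (s ℕ.+ j))) ⟩
    sumFrom 1 k (λ j → f (s ℕ.+ j))             ∎)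

  sumFrom-+ : ∀ s k f g → sumFrom s k (λ j → f j + g j) ≈ sumFrom s k f + sumFrom s k g
  sumFrom-+ s zero    f g = ≈-sym (+-identityˡ 0#)
  sumFrom-+ s (suc k) f g =
    ≈-trans (+-congˡ (sumFrom-+ (suc s) k f g)) (interchange (f s) (g s) (sumFrom (suc s) k f) (sumFrom (suc s) k g))

  sumFrom-*ˡ : ∀ s k c f → sumFrom s k (λ j → c * f j) ≈ c * sumFrom s k f
  sumFrom-*ˡ s zero    c f = ≈-sym (zeroʳ c)
  sumFrom-*ˡ s (suc k) c f = ≈-trans (+-congˡ (sumFrom-*ˡ (suc s) k c f)) (≈-sym (distribˡ c _ _))

  sumFrom-zero : ∀ s k {f} → (∀ j → s ℕ.≤ j → j ℕ.< s ℕ.+ k → f j ≈ 0#) → sumFrom s k f ≈ 0#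
  sumFrom-zero s k {f} f≈0 = ≈-trans (sumFrom-cong s k f≈0) (zero-terms s k)
    where
    zero-terms : ∀ s k → sumFrom s k (λ _ → 0#) ≈ 0#
    zero-terms s zero    = ≈-refl
    zero-terms s (suc k) = ≈-trans (+-identityˡ _) (zero-terms (suc s) k)

module ℚ-Sum = RangeSum ℚ.+-*-commutativeRing
module ℤ-Sum = RangeSum ℤ.+-*-commutativeRing

-- Polynomial identities over ℤ

module Polynomial where
  open import Data.Integer using (+_; -_; _+_; _-_; _*_; _≤_; +≤+; -≤+)
  open import Data.Integer.Tactic.RingSolver using (solve-∀)
  open ℤ-Sum

  -- The polynomials below are INLINE so that the ring solver sees through them.
  quad : ℤ → ℤ → ℤ → ℤ → ℤ
  quad γ α β i = γ + (α + i) * (β - i)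
  {-# INLINE quad #-}

  quadSum6 : ℤ → ℤ → ℤ → ℤ → ℤ
  quadSum6 N γ α β = + 6 * N * (γ + α * β) + + 3 * (β - α) * N * (N - + 1) - (N - + 1) * N * (+ 2 * N - + 1)
  {-# INLINE quadSum6 #-}

  sum-quad : ∀ N γ α β → + 6 * sumFrom 0 N (λ i → quad γ α β (+ i)) ≡ quadSum6 (+ N) γ α β
  sum-quad zero    γ α β = base γ α β
    where
    base : ∀ γ α β → + 6 * + 0 ≡ quadSum6 (+ 0) γ α β
    base = solve-∀
  sum-quad (suc N) γ α β = begin
    + 6 * sumFrom 0 (suc N) q            ≡⟨ cong (+ 6 *_) (sumFrom-last 0 N q) ⟩
    + 6 * (sumFrom 0 N q + q N)          ≡⟨ ℤ.*-distribˡ-+ (+ 6) (sumFrom 0 N q) (q N) ⟩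
    + 6 * sumFrom 0 N q + + 6 * q N      ≡⟨ cong (_+ + 6 * q N) (sum-quad N γ α β) ⟩
    quadSum6 (+ N) γ α β + + 6 * q N     ≡⟨ step (+ N) γ α β ⟩
    quadSum6 (+ suc N) γ α β             ∎
    where
    open ≡-Reasoning
    q : ℕ → ℤ
    q i = quad γ α β (+ i)
    step : ∀ N γ α β → quadSum6 N γ α β + + 6 * quad γ α β N ≡ quadSum6 (+ 1 + N) γ α β
    step = solve-∀

  -- leftVolume L i and rightVolume R e i are the volumes of the two sides of the path edge {i, i+1};
  -- leftProfile/rightProfile are the hitting times left/right of a path vertex a whose hitting time is c.
  leftVolume : ℤ → ℤ → ℤ
  leftVolume L i = + 2 * L + + 2 * i + + 1
  {-# INLINE leftVolume #-}

  rightVolume : ℤ → ℤ → ℤ → ℤ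
  rightVolume R e i = + 2 * R + + 2 * (e - i) - + 1
  {-# INLINE rightVolume #-}

  leftProfile : ℤ → ℤ → ℤ → ℤ → ℤ
  leftProfile L a c i = quad c (+ 2 * L + a) a i
  {-# INLINE leftProfile #-}

  rightProfile : ℤ → ℤ → ℤ → ℤ → ℤ → ℤ
  rightProfile R e a c k = quad c (+ 0) (+ 2 * R + + 2 * e - + 2 * a) k
  {-# INLINE rightProfile #-}

  leftVolume-first : ∀ L → (+ 1 + L) + L ≡ leftVolume L (+ 0)
  leftVolume-first = solve-∀

  leftVolume-next : ∀ L i → (+ 1 + + 1) + leftVolume L i ≡ leftVolume L (+ 1 + i)
  leftVolume-next = solve-∀

  rightVolume-last : ∀ R i → (+ 1 + R) + R ≡ rightVolume R (+ 1 + i) i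
  rightVolume-last = solve-∀

  rightVolume-next : ∀ R e i → (+ 1 + + 1) + rightVolume R e (+ 1 + i) ≡ rightVolume R e i
  rightVolume-next = solve-∀

  leftProfile-anchor : ∀ L a c → c ≡ leftProfile L a c a
  leftProfile-anchor = solve-∀

  leftProfile-step : ∀ L a c i → leftProfile L a c i ≡ leftProfile L a c (+ 1 + i) + leftVolume L i
  leftProfile-step = solve-∀

  rightProfile-anchor : ∀ R e a c → c ≡ rightProfile R e a c (+ 0)
  rightProfile-anchor = solve-∀

  rightProfile-step : ∀ R e a c k → rightProfile R e a c (+ 1 + k) ≡ rightProfile R e a c k + rightVolume R e (a + k)
  rightProfile-step = solve-∀

  leafTarget-first : ∀ L R e → (+ 1 + L) + (rightVolume R e (+ 0) + (L - + 1)) ≡ + 2 * (e + L + R) - + 1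
  leafTarget-first = solve-∀

  leafTarget-last : ∀ L R i → (+ 1 + R) + (leftVolume L i + (R - + 1)) ≡ + 2 * ((+ 1 + i) + L + R) - + 1
  leafTarget-last = solve-∀

  leafTarget-star : ∀ L R → (+ 1 + (L + R - + 1)) + (L + R - + 1) ≡ + 2 * (+ 0 + L + R) - + 1
  leafTarget-star = solve-∀

  suc-pred : ∀ a → a ≡ + 1 + (a - + 1)
  suc-pred = solve-∀

  -- Σ_u deg(u)·H(u, v) when H(·, v) follows the profiles anchored at path vertex a with value c
  -- (a + j = e), and εL/εR = 1 exactly when v is a left/right leaf.
  weightedProfile : (L R c εL εR : ℤ) (a j : ℕ) → ℤ
  weightedProfile L R c εL εR a j =
    (L - + 1) * x + (R - + 1) * y + + 2 * (pathLeft + pathRight) + (L - εL) * (+ 1 + x) + (R - εR) * (+ 1 + y)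
    where
    e = + a + + j
    x = leftProfile L (+ a) c (+ 0)
    y = rightProfile R e (+ a) c (+ j)
    pathLeft = sumFrom 0 a (λ i → leftProfile L (+ a) c (+ i))
    pathRight = sumFrom 0 (suc j) (λ k → rightProfile R e (+ a) c (+ k))

  -- Six times Σ_u deg(u)·H(u, t) for a path vertex t.
  Φ6 : ℤ → ℤ → ℤ → ℤ → ℤ
  Φ6 L R e t = + 6 * (+ 2 * L - + 1) * t * (+ 2 * L + t) + + 6 * (+ 2 * R - + 1) * (e - t) * (+ 2 * R + (e - t))
             + + 6 * (L + R)
             + + 2 * (t * (t + + 1) * (+ 6 * L + + 4 * t - + 1) + (e - t) * (e - t + + 1) * (+ 6 * R + + 4 * (e - t) - + 1))
  {-# INLINE Φ6 #-}

  six-weightedProfile : ∀ L R c εL εR a j →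
    + 6 * weightedProfile L R c εL εR a j
      ≡ Φ6 L R (+ a + + j) (+ a) + + 6 * (+ 2 * (+ a + + j + L + R) * c
                                          - εL * (+ 1 + c + leftProfile L (+ a) (+ 0) (+ 0))
                                          - εR * (+ 1 + c + rightProfile R (+ a + + j) (+ a) (+ 0) (+ j)))
  six-weightedProfile L R c εL εR a j = begin
    + 6 * weightedProfile L R c εL εR a j                      ≡⟨ separate L R εL εR x y S₁ S₂ ⟩
    + 6 * ends + + 2 * (+ 6 * S₁) + + 2 * (+ 6 * S₂)
      ≡⟨ cong₂ (λ u w → + 6 * ends + + 2 * u + + 2 * w)
        (sum-quad a c (+ 2 * L + + a) (+ a))
        (sum-quad (suc j) c (+ 0) (+ 2 * R + + 2 * e - + 2 * + a)) ⟩
    + 6 * ends + + 2 * quadSum6 (+ a) c (+ 2 * L + + a) (+ a)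
               + + 2 * quadSum6 (+ suc j) c (+ 0) (+ 2 * R + + 2 * e - + 2 * + a)
                                                                ≡⟨ closed L R c εL εR (+ a) (+ j) ⟩
    Φ6 L R e (+ a) + + 6 * (+ 2 * (e + L + R) * c - εL * (+ 1 + c + leftProfile L (+ a) (+ 0) (+ 0))
                                                  - εR * (+ 1 + c + rightProfile R e (+ a) (+ 0) (+ j))) ∎
    where
    open ≡-Reasoning
    e = + a + + j
    x = leftProfile L (+ a) c (+ 0)
    y = rightProfile R e (+ a) c (+ j)
    S₁ = sumFrom 0 a (λ i → leftProfile L (+ a) c (+ i))
    S₂ = sumFrom 0 (suc j) (λ k → rightProfile R e (+ a) c (+ k))
    ends = (L - + 1) * x + (R - + 1) * y + (L - εL) * (+ 1 + x) + (R - εR) * (+ 1 + y)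
    separate : ∀ L R εL εR x y S₁ S₂ →
      + 6 * ((L - + 1) * x + (R - + 1) * y + + 2 * (S₁ + S₂) + (L - εL) * (+ 1 + x) + (R - εR) * (+ 1 + y))
        ≡ + 6 * ((L - + 1) * x + (R - + 1) * y + (L - εL) * (+ 1 + x) + (R - εR) * (+ 1 + y))
          + + 2 * (+ 6 * S₁) + + 2 * (+ 6 * S₂)
    separate = solve-∀
    closed : ∀ L R c εL εR a j → let e = a + j; x = leftProfile L a c (+ 0); y = rightProfile R e a c j in
      + 6 * ((L - + 1) * x + (R - + 1) * y + (L - εL) * (+ 1 + x) + (R - εR) * (+ 1 + y))
        + + 2 * quadSum6 a c (+ 2 * L + a) a + + 2 * quadSum6 (+ 1 + j) c (+ 0) (+ 2 * R + + 2 * e - + 2 * a)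
      ≡ Φ6 L R e a + + 6 * (+ 2 * (e + L + R) * c - εL * (+ 1 + c + leftProfile L a (+ 0) (+ 0))
                                                  - εR * (+ 1 + c + rightProfile R e a (+ 0) j))
    closed = solve-∀

  no-correction : ∀ Φ L R a j →
    Φ + + 6 * (+ 2 * (a + j + L + R) * + 0 - + 0 * (+ 1 + + 0 + leftProfile L a (+ 0) (+ 0))
                                         - + 0 * (+ 1 + + 0 + rightProfile R (a + j) a (+ 0) j)) ≡ Φ
  no-correction = solve-∀

  leftLeaf-correction : ∀ Φ e L R → let m = e + L + R; c = + 2 * m - + 1 in
    Φ + + 6 * (+ 2 * (+ 0 + e + L + R) * c - + 1 * (+ 1 + c + leftProfile L (+ 0) (+ 0) (+ 0))
                                           - + 0 * (+ 1 + c + rightProfile R (+ 0 + e) (+ 0) (+ 0) e))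
      ≡ Φ + + 24 * m * (m - + 1)
  leftLeaf-correction = solve-∀

  rightLeaf-correction : ∀ Φ e L R → let m = e + L + R; c = + 2 * m - + 1 in
    Φ + + 6 * (+ 2 * (e + + 0 + L + R) * c - + 0 * (+ 1 + c + leftProfile L e (+ 0) (+ 0))
                                           - + 1 * (+ 1 + c + rightProfile R (e + + 0) e (+ 0) (+ 0)))
      ≡ Φ + + 24 * m * (m - + 1)
  rightLeaf-correction = solve-∀

  -- Φ6 is a quadratic in t, minimised over the integers at t = ks where e + δ = 2·ks + ε.
  Φ6-shift : ∀ L R e δ ks ε t → R ≡ L + δ → e ≡ + 2 * ks + ε - δ →
    Φ6 L R e t ≡ Φ6 L R e ks + + 24 * (e + L + R) * (t - ks) * (t - ks - ε)
  Φ6-shift L _ _ δ ks ε t refl refl = shift L δ ks ε t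
    where
    shift : ∀ L δ ks ε t → let R = L + δ; e = + 2 * ks + ε - δ in
      Φ6 L R e t ≡ Φ6 L R e ks + + 24 * (e + L + R) * (t - ks) * (t - ks - ε)
    shift = solve-∀

  0≤i∧0≤j⇒0≤i*j : ∀ {a b} → + 0 ≤ a → + 0 ≤ b → + 0 ≤ a * b
  0≤i∧0≤j⇒0≤i*j {a} {b} 0≤a 0≤b =
    subst (_≤ a * b) (ℤ.*-zeroʳ a) (ℤ.*-monoˡ-≤-nonNeg a {{ℤ.nonNegative 0≤a}} 0≤b)

  i≤0∧j≤0⇒0≤i*j : ∀ {a b} → a ≤ + 0 → b ≤ + 0 → + 0 ≤ a * b
  i≤0∧j≤0⇒0≤i*j {a} {b} a≤0 b≤0 =
    subst (+ 0 ≤_) (negate a b) (0≤i∧0≤j⇒0≤i*j (ℤ.neg-mono-≤ a≤0) (ℤ.neg-mono-≤ b≤0))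
    where
    negate : ∀ a b → (- a) * (- b) ≡ a * b
    negate = solve-∀

  0≤i*[i-ε] : ∀ i ε → ε ℕ.≤ 1 → + 0 ≤ i * (i - + ε)
  0≤i*[i-ε] (+ zero)    ε _   = ℤ.≤-reflexive (sym (ℤ.*-zeroˡ (+ 0 - + ε)))
  0≤i*[i-ε] ℤ.+[1+ k ] ε ε≤1 = 0≤i∧0≤j⇒0≤i*j {ℤ.+[1+ k ]} {ℤ.+[1+ k ] - + ε}
    (+≤+ ℕ.z≤n) (ℤ.i≤j⇒0≤j-i (+≤+ (ℕ.≤-trans ε≤1 (ℕ.s≤s ℕ.z≤n))))
  0≤i*[i-ε] ℤ.-[1+ k ] ε _   = i≤0∧j≤0⇒0≤i*j {ℤ.-[1+ k ]} {ℤ.-[1+ k ] - + ε}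
    -≤+ (ℤ.i≤j⇒i-k≤j (+ ε) -≤+)

  0≤j⇒i≤i+j : ∀ i {j} → + 0 ≤ j → i ≤ i + j
  0≤j⇒i≤i+j i {j} 0≤j = ℤ.i≤i+j i j {{ℤ.nonNegative 0≤j}}

  0≤24m[m-1] : ∀ m → + 0 ≤ + 24 * m * (m - + 1)
  0≤24m[m-1] m = subst (+ 0 ≤_) (sym (ℤ.*-assoc (+ 24) m (m - + 1)))
    (0≤i∧0≤j⇒0≤i*j {+ 24} (+≤+ ℕ.z≤n) (0≤i*[i-ε] m 1 ℕ.≤-refl))

  Φ6-minimum : ∀ L R e δ ks ε t → ε ℕ.≤ 1 → + 0 ≤ e + L + R → R ≡ L + δ → e ≡ + 2 * ks + + ε - δ →
    Φ6 L R e ks ≤ Φ6 L R e t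
  Φ6-minimum L R e δ ks ε t ε≤1 0≤m R≡ e≡ =
    subst (Φ6 L R e ks ≤_) (sym (Φ6-shift L R e δ ks (+ ε) t R≡ e≡))
      (0≤j⇒i≤i+j (Φ6 L R e ks) (subst (+ 0 ≤_) (sym (regroup (e + L + R) (t - ks) (+ ε)))
        (0≤i∧0≤j⇒0≤i*j (0≤i∧0≤j⇒0≤i*j {+ 24} (+≤+ ℕ.z≤n) 0≤m) (0≤i*[i-ε] (t - ks) ε ε≤1))))
    where
    regroup : ∀ m x ε → + 24 * m * x * (x - ε) ≡ + 24 * m * (x * (x - ε))
    regroup = solve-∀

  formulaX : ℤ → ℤ → ℤ → ℤ
  formulaX N D c = (D - + 2) * N - D * D + + 3 * D - c
  {-# INLINE formulaX #-}

  formulaY : ℤ → ℤ → ℤ → ℤ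
  formulaY D e f = D * D * D - + 6 * D * D + e * D - f
  {-# INLINE formulaY #-}

  Φ6-optimum : ∀ ε δ → ε ℕ.≤ 1 → δ ℕ.≤ 1 → ∀ L R e ks N D → R ≡ L + + δ → e ≡ + 2 * ks + + ε - + δ →
    D ≡ e + + 2 → N ≡ e + L + R + + 1 →
    Φ6 L R e ks ≡ + 2 * (+ 3 * (N - + 1) * formulaX N D (+ 1 + + δ - + ε) + formulaY D (+ 8 + + 3 * + δ) (+ 6 * + δ))
  Φ6-optimum 0 0 _ _ L _ _ ks _ _ refl refl refl refl = optimum L ks
    where
    optimum : ∀ L ks → let R = L + + 0; e = + 2 * ks + + 0 - + 0; D = e + + 2; N = e + L + R + + 1 in
      Φ6 L R e ks ≡ + 2 * (+ 3 * (N - + 1) * formulaX N D (+ 1 + + 0 - + 0) + formulaY D (+ 8 + + 3 * + 0) (+ 6 * + 0))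
    optimum = solve-∀
  Φ6-optimum 0 1 _ _ L _ _ ks _ _ refl refl refl refl = optimum L ks
    where
    optimum : ∀ L ks → let R = L + + 1; e = + 2 * ks + + 0 - + 1; D = e + + 2; N = e + L + R + + 1 in
      Φ6 L R e ks ≡ + 2 * (+ 3 * (N - + 1) * formulaX N D (+ 1 + + 1 - + 0) + formulaY D (+ 8 + + 3 * + 1) (+ 6 * + 1))
    optimum = solve-∀
  Φ6-optimum 1 0 _ _ L _ _ ks _ _ refl refl refl refl = optimum L ks
    where
    optimum : ∀ L ks → let R = L + + 0; e = + 2 * ks + + 1 - + 0; D = e + + 2; N = e + L + R + + 1 in
      Φ6 L R e ks ≡ + 2 * (+ 3 * (N - + 1) * formulaX N D (+ 1 + + 0 - + 1) + formulaY D (+ 8 + + 3 * + 0) (+ 6 * + 0))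
    optimum = solve-∀
  Φ6-optimum 1 1 _ _ L _ _ ks _ _ refl refl refl refl = optimum L ks
    where
    optimum : ∀ L ks → let R = L + + 1; e = + 2 * ks + + 1 - + 1; D = e + + 2; N = e + L + R + + 1 in
      Φ6 L R e ks ≡ + 2 * (+ 3 * (N - + 1) * formulaX N D (+ 1 + + 1 - + 1) + formulaY D (+ 8 + + 3 * + 1) (+ 6 * + 1))
    optimum = solve-∀
  Φ6-optimum (suc (suc _)) _ (ℕ.s≤s ()) _
  Φ6-optimum _ (suc (suc _)) _ (ℕ.s≤s ())

  solve-for-e : ∀ e δ ε ks → e + δ ≡ ε + ks * + 2 → e ≡ + 2 * ks + ε - δ
  solve-for-e e δ ε ks e+δ≡ = trans (add-sub e δ) (trans (cong (_- δ) e+δ≡) (reorder ε ks δ))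
    where
    add-sub : ∀ a b → a ≡ a + b - b
    add-sub = solve-∀
    reorder : ∀ ε ks δ → ε + ks * + 2 - δ ≡ + 2 * ks + ε - δ
    reorder = solve-∀

-- Opened only now: the identities above use the operators of ℤ unqualified.
open import Data.Rational using (ℚ; mkℚ; 0ℚ; 1ℚ; _+_; _*_; _-_; -_; _/_; _≤_)

ℤ→ℚ : ℤ → ℚ
ℤ→ℚ i = i / 1

private
  integral : ℤ → ℚ
  integral i = mkℚ i 0 (coprime-sym (1-coprimeTo ℤ.∣ i ∣))

  ℤ→ℚ-integral : ∀ i → ℤ→ℚ i ≡ integral i
  ℤ→ℚ-integral i = ℚ.↥p/↧p≡p (integral i)

ℤ→ℚ-homo-+ : ∀ i j → ℤ→ℚ (i ℤ.+ j) ≡ ℤ→ℚ i + ℤ→ℚ j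
ℤ→ℚ-homo-+ i j rewrite ℤ→ℚ-integral i | ℤ→ℚ-integral j =
  cong (_/ 1) (sym (cong₂ ℤ._+_ (ℤ.*-identityʳ i) (ℤ.*-identityʳ j)))

ℤ→ℚ-homo-* : ∀ i j → ℤ→ℚ (i ℤ.* j) ≡ ℤ→ℚ i * ℤ→ℚ j
ℤ→ℚ-homo-* i j rewrite ℤ→ℚ-integral i | ℤ→ℚ-integral j = refl

ℤ→ℚ-homo‿- : ∀ i → ℤ→ℚ (ℤ.- i) ≡ - ℤ→ℚ i
ℤ→ℚ-homo‿- i rewrite ℤ→ℚ-integral i | ℤ→ℚ-integral (ℤ.- i) = integral-neg i
  where
  integral-neg : ∀ i → integral (ℤ.- i) ≡ - integral i
  integral-neg (ℤ.+ zero)   = refl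
  integral-neg ℤ.+[1+ _ ] = refl
  integral-neg ℤ.-[1+ _ ] = refl

ℤ→ℚ-homo-− : ∀ i j → ℤ→ℚ (i ℤ.- j) ≡ ℤ→ℚ i - ℤ→ℚ j
ℤ→ℚ-homo-− i j = trans (ℤ→ℚ-homo-+ i (ℤ.- j)) (cong (λ x → ℤ→ℚ i + x) (ℤ→ℚ-homo‿- j))

ℤ→ℚ-mono-≤ : ∀ {i j} → i ℤ.≤ j → ℤ→ℚ i ≤ ℤ→ℚ j
ℤ→ℚ-mono-≤ {i} {j} i≤j rewrite ℤ→ℚ-integral i | ℤ→ℚ-integral j =
  ℚ.*≤* (subst₂ ℤ._≤_ (sym (ℤ.*-identityʳ i)) (sym (ℤ.*-identityʳ j)) i≤j)

ℤ→ℚ-1+ : ∀ k → ℤ→ℚ (ℤ.+ 1 ℤ.+ k) ≡ 1ℚ + ℤ→ℚ k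
ℤ→ℚ-1+ k = ℤ→ℚ-homo-+ (ℤ.+ 1) k

fraction-split : ∀ a b .{{_ : NonZero b}} → (ℤ.+ a) / b ≡ ℕ→ℚ a * ((ℤ.+ 1) / b)
fraction-split a (suc b) = ℚ.toℚᵘ-injective (begin
  ℚ.toℚᵘ ((ℤ.+ a) / suc b)                         ≈⟨ ℚ.toℚᵘ-fromℚᵘ (mkℚᵘ (ℤ.+ a) b) ⟩
  mkℚᵘ (ℤ.+ a) b                                    ≈⟨ *≡* (cong₂ ℤ._*_ (sym (ℤ.*-identityʳ (ℤ.+ a)))
                                                                         (cong (λ z → ℤ.+ suc z) (ℕ.+-identityʳ b))) ⟩
  mkℚᵘ (ℤ.+ a) 0 ℚᵘ.* mkℚᵘ (ℤ.+ 1) b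
    ≈⟨ ℚᵘ.*-cong (back (mkℚᵘ (ℤ.+ a) 0)) (back (mkℚᵘ (ℤ.+ 1) b)) ⟩
  ℚ.toℚᵘ (ℕ→ℚ a) ℚᵘ.* ℚ.toℚᵘ ((ℤ.+ 1) / suc b)
    ≈⟨ ℚᵘ.≃-sym (ℚ.toℚᵘ-homo-* (ℕ→ℚ a) ((ℤ.+ 1) / suc b)) ⟩
  ℚ.toℚᵘ (ℕ→ℚ a * ((ℤ.+ 1) / suc b))               ∎)
  where
  open ℚᵘ.≃-Reasoning
  back : ∀ r → r ℚᵘ.≃ ℚ.toℚᵘ (ℚ.fromℚᵘ r)
  back r = ℚᵘ.≃-sym (ℚ.toℚᵘ-fromℚᵘ r)

*-reciprocal : ∀ b .{{_ : NonZero b}} → ℕ→ℚ b * ((ℤ.+ 1) / b) ≡ 1ℚ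
*-reciprocal (suc b) = trans (sym (fraction-split (suc b) (suc b)))
  (ℚ.fromℚᵘ-cong {mkℚᵘ (ℤ.+ suc b) b} {mkℚᵘ (ℤ.+ 1) 0} (*≡* (ℤ.*-comm (ℤ.+ suc b) (ℤ.+ 1))))

ℕ→ℚ-homo-+ : ∀ m n → ℕ→ℚ (m ℕ.+ n) ≡ ℕ→ℚ m + ℕ→ℚ n
ℕ→ℚ-homo-+ m n = trans (cong ℤ→ℚ (ℤ.pos-+ m n)) (ℤ→ℚ-homo-+ (ℤ.+ m) (ℤ.+ n))

open ℚ-Sum

sumFrom-ℤ→ℚ : ∀ s k f → sumFrom s k (λ j → ℤ→ℚ (f j)) ≡ ℤ→ℚ (ℤ-Sum.sumFrom s k f)
sumFrom-ℤ→ℚ s zero    f = refl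
sumFrom-ℤ→ℚ s (suc k) f =
  trans (cong (λ x → ℤ→ℚ (f s) + x) (sumFrom-ℤ→ℚ (suc s) k f)) (sym (ℤ→ℚ-homo-+ (f s) _))

sumFrom-const : ∀ s k c → sumFrom s k (λ _ → c) ≡ ℕ→ℚ k * c
sumFrom-const s zero    c = sym (ℚ.*-zeroˡ c)
sumFrom-const s (suc k) c = begin
  c + sumFrom (suc s) k (λ _ → c)  ≡⟨ cong (c +_) (sumFrom-const (suc s) k c) ⟩
  c + ℕ→ℚ k * c                    ≡⟨ cong (_+ ℕ→ℚ k * c) (ℚ.*-identityˡ c) ⟨
  1ℚ * c + ℕ→ℚ k * c               ≡⟨ ℚ.*-distribʳ-+ c 1ℚ (ℕ→ℚ k) ⟨
  (1ℚ + ℕ→ℚ k) * c                 ≡⟨ cong (_* c) (ℕ→ℚ-homo-+ 1 k) ⟨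
  ℕ→ℚ (suc k) * c                  ∎
  where open ≡-Reasoning

sumFin-cong : ∀ n {f g : Fin n → ℚ} → (∀ w → f w ≡ g w) → sumFin n f ≡ sumFin n g
sumFin-cong zero    f≡g = refl
sumFin-cong (suc n) f≡g = cong₂ _+_ (f≡g Fin.zero) (sumFin-cong n (λ w → f≡g (Fin.suc w)))

sumFin-sumFrom : ∀ n s (g : ℕ → ℚ) → sumFin n (λ w → g (s ℕ.+ toℕ w)) ≡ sumFrom s n g
sumFin-sumFrom zero    s g = refl
sumFin-sumFrom (suc n) s g = cong₂ _+_ (cong g (ℕ.+-identityʳ s))
  (trans (sumFin-cong n (λ w → cong g (ℕ.+-suc s (toℕ w)))) (sumFin-sumFrom n (suc s) g))

ℕ→ℚ-sumFinℕ : ∀ n (f : Fin n → ℕ) → ℕ→ℚ (sumFinℕ n f) ≡ sumFin n (λ w → ℕ→ℚ (f w))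
ℕ→ℚ-sumFinℕ zero    f = refl
ℕ→ℚ-sumFinℕ (suc n) f = trans (ℕ→ℚ-homo-+ (f Fin.zero) _)
  (cong (ℕ→ℚ (f Fin.zero) +_) (ℕ→ℚ-sumFinℕ n (λ w → f (Fin.suc w))))

sumFrom-ones : ∀ s k → sumFrom s k (λ _ → 1ℚ) ≡ ℕ→ℚ k
sumFrom-ones s k = trans (sumFrom-const s k 1ℚ) (ℚ.*-identityʳ (ℕ→ℚ k))

sumFrom-constant : ∀ s k {f : ℕ → ℚ} c → (∀ j → s ℕ.≤ j → j ℕ.< s ℕ.+ k → f j ≡ c) →
                   sumFrom s k f ≡ ℕ→ℚ k * c
sumFrom-constant s k c f≡c = trans (sumFrom-cong s k f≡c) (sumFrom-const s k c)

sumFrom-constant-but-one : ∀ s k t {f : ℕ → ℚ} c → s ℕ.≤ t → t ℕ.< s ℕ.+ k → f t ≡ 0ℚ →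
  (∀ j → s ℕ.≤ j → j ℕ.< s ℕ.+ k → j ≢ t → f j ≡ c) → sumFrom s k f ≡ (ℕ→ℚ k - 1ℚ) * c
sumFrom-constant-but-one s zero t c s≤t t<s+0 _ _ =
  ⊥-elim (ℕ.<⇒≱ t<s+0 (subst (ℕ._≤ t) (sym (ℕ.+-identityʳ s)) s≤t))
sumFrom-constant-but-one s (suc k) t {f} c s≤t t<s+k+1 ft≡0 f≡c = by-cases (s ℕ.≟ t)
  where
  open ≡-Reasoning
  open +-*-Solver
  later : ∀ {j} → j ℕ.< suc s ℕ.+ k → j ℕ.< s ℕ.+ suc k
  later j<s+k+1 = ℕ.<-≤-trans j<s+k+1 (ℕ.≤-reflexive (sym (ℕ.+-suc s k)))
  by-cases : Dec (s ≡ t) → sumFrom s (suc k) f ≡ (ℕ→ℚ (suc k) - 1ℚ) * c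
  by-cases (yes refl) = begin
    f s + sumFrom (suc s) k f    ≡⟨ cong₂ _+_ ft≡0 (sumFrom-constant (suc s) k c λ j s<j j<s+k+1 →
                                      f≡c j (ℕ.<⇒≤ s<j) (later j<s+k+1) (ℕ.>⇒≢ s<j)) ⟩
    0ℚ + ℕ→ℚ k * c               ≡⟨ first-excluded (ℕ→ℚ k) c ⟩
    ((1ℚ + ℕ→ℚ k) - 1ℚ) * c      ≡⟨ cong (λ x → (x - 1ℚ) * c) (ℕ→ℚ-homo-+ 1 k) ⟨
    (ℕ→ℚ (suc k) - 1ℚ) * c       ∎
    where
    first-excluded : ∀ k c → 0ℚ + k * c ≡ ((1ℚ + k) - 1ℚ) * c
    first-excluded = solve 2 (λ k c → con 0ℚ :+ k :* c := (con 1ℚ :+ k :- con 1ℚ) :* c) refl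
  by-cases (no s≢t) = begin
    f s + sumFrom (suc s) k f    ≡⟨ cong₂ _+_ (f≡c s ℕ.≤-refl (ℕ.≤-<-trans s≤t t<s+k+1) s≢t) rest ⟩
    c + (ℕ→ℚ k - 1ℚ) * c         ≡⟨ later-excluded (ℕ→ℚ k) c ⟩
    ((1ℚ + ℕ→ℚ k) - 1ℚ) * c      ≡⟨ cong (λ x → (x - 1ℚ) * c) (ℕ→ℚ-homo-+ 1 k) ⟨
    (ℕ→ℚ (suc k) - 1ℚ) * c       ∎
    where
    s<t = ℕ.≤∧≢⇒< s≤t s≢t
    rest = sumFrom-constant-but-one (suc s) k t c s<t (subst (t ℕ.<_) (ℕ.+-suc s k) t<s+k+1) ft≡0
             λ j s<j j<s+k+1 → f≡c j (ℕ.<⇒≤ s<j) (later j<s+k+1)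
    later-excluded : ∀ k c → c + (k - 1ℚ) * c ≡ ((1ℚ + k) - 1ℚ) * c
    later-excluded = solve 2 (λ k c → c :+ (k :- con 1ℚ) :* c := (con 1ℚ :+ k :- con 1ℚ) :* c) refl

extend : ∀ {n} → (Fin n → ℚ) → ℕ → ℚ
extend {n} g j with j ℕ.<? n
... | yes j<n = g (Fin.fromℕ< j<n)
... | no  _   = 0ℚ

extend-toℕ : ∀ {n} (g : Fin n → ℚ) w → extend g (toℕ w) ≡ g w
extend-toℕ {n} g w with toℕ w ℕ.<? n
... | yes w<n = cong g (Fin.fromℕ<-toℕ w w<n)
... | no  w≮n = ⊥-elim (w≮n (Fin.toℕ<n w))

<ᵇ-true : ∀ {m n} → m ℕ.< n → (m ℕ.<ᵇ n) ≡ true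
<ᵇ-true m<n = Equivalence.to T-≡ (ℕ.<⇒<ᵇ m<n)

<ᵇ-false : ∀ {m n} → n ℕ.≤ m → (m ℕ.<ᵇ n) ≡ false
<ᵇ-false {m} {n} n≤m with m ℕ.<ᵇ n in eq
... | false = refl
... | true  = ⊥-elim (ℕ.<⇒≱ (ℕ.<ᵇ⇒< m n (Equivalence.from T-≡ eq)) n≤m)

≡ᵇ-false : ∀ {m k} → m ≢ k → (m ℕ.≡ᵇ k) ≡ false
≡ᵇ-false {m} {k} m≢k with m ℕ.≡ᵇ k in eq
... | false = refl
... | true  = ⊥-elim (m≢k (ℕ.≡ᵇ⇒≡ m k (Equivalence.from T-≡ eq)))

≡ᵇ-true : ∀ {m k} → m ≡ k → (m ℕ.≡ᵇ k) ≡ true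
≡ᵇ-true {m} refl = Equivalence.to T-≡ (ℕ.≡⇒≡ᵇ m m refl)

𝟙 : Bool → ℚ
𝟙 b = ℕ→ℚ (ind b)

_⁇_ : Bool → ℚ → ℚ
b ⁇ x = if b then x else 0ℚ

sum-guarded : ∀ n c (g : ℕ → Bool) (f : ℕ → ℚ) →
  sumFrom 0 n (λ j → 𝟙 (c ∧ g j) * f j) ≡ c ⁇ sumFrom 0 n (λ j → 𝟙 (g j) * f j)
sum-guarded n true  g f = refl
sum-guarded n false g f = sumFrom-zero 0 n (λ j _ _ → ℚ.*-zeroˡ (f j))

sum-range : ∀ n lo hi (f : ℕ → ℚ) → lo ℕ.≤ hi → hi ℕ.≤ n →
  sumFrom 0 n (λ j → 𝟙 ((lo ℕ.<ᵇ suc j) ∧ (j ℕ.<ᵇ hi)) * f j) ≡ sumFrom lo (hi ∸ lo) f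
sum-range n lo hi f lo≤hi hi≤n = begin
  sumFrom 0 n g
    ≡⟨ cong (λ k → sumFrom 0 k g) n≡ ⟩
  sumFrom 0 (lo ℕ.+ (hi ∸ lo ℕ.+ (n ∸ hi))) g
    ≡⟨ sumFrom-split 0 lo _ g ⟩
  sumFrom 0 lo g + sumFrom lo (hi ∸ lo ℕ.+ (n ∸ hi)) g
    ≡⟨ cong₂ _+_ below (sumFrom-split lo (hi ∸ lo) _ g) ⟩
  0ℚ + (sumFrom lo (hi ∸ lo) g + sumFrom (lo ℕ.+ (hi ∸ lo)) (n ∸ hi) g)
    ≡⟨ ℚ.+-identityˡ _ ⟩
  sumFrom lo (hi ∸ lo) g + sumFrom (lo ℕ.+ (hi ∸ lo)) (n ∸ hi) g
    ≡⟨ cong₂ _+_ inside above ⟩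
  sumFrom lo (hi ∸ lo) f + 0ℚ
    ≡⟨ ℚ.+-identityʳ _ ⟩
  sumFrom lo (hi ∸ lo) f
    ∎
  where
  open ≡-Reasoning
  g = λ j → 𝟙 ((lo ℕ.<ᵇ suc j) ∧ (j ℕ.<ᵇ hi)) * f j
  lo+[hi∸lo] : lo ℕ.+ (hi ∸ lo) ≡ hi
  lo+[hi∸lo] = ℕ.m+[n∸m]≡n lo≤hi
  n≡ : n ≡ lo ℕ.+ (hi ∸ lo ℕ.+ (n ∸ hi))
  n≡ = sym (trans (sym (ℕ.+-assoc lo _ _)) (trans (cong (ℕ._+ (n ∸ hi)) lo+[hi∸lo]) (ℕ.m+[n∸m]≡n hi≤n)))
  below = sumFrom-zero 0 lo λ j _ j<lo →
    trans (cong (λ b → 𝟙 (b ∧ (j ℕ.<ᵇ hi)) * f j) (<ᵇ-false (ℕ.s≤s j<lo))) (ℚ.*-zeroˡ (f j))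
  inside = sumFrom-cong lo (hi ∸ lo) λ j lo≤j j<hi →
    trans (cong₂ (λ b b′ → 𝟙 (b ∧ b′) * f j) (<ᵇ-true (ℕ.s≤s lo≤j))
                 (<ᵇ-true (subst (j ℕ.<_) lo+[hi∸lo] j<hi)))
          (ℚ.*-identityˡ (f j))
  above = sumFrom-zero (lo ℕ.+ (hi ∸ lo)) (n ∸ hi) λ j hi≤j _ →
    trans (cong (λ b → 𝟙 ((lo ℕ.<ᵇ suc j) ∧ b) * f j) (<ᵇ-false (subst (ℕ._≤ j) lo+[hi∸lo] hi≤j)))
          (trans (cong (λ b → 𝟙 b * f j) (∧-zeroʳ (lo ℕ.<ᵇ suc j))) (ℚ.*-zeroˡ (f j)))

≡ᵇ-as-range : ∀ a j → (a ℕ.≡ᵇ j) ≡ (a ℕ.<ᵇ suc j) ∧ (j ℕ.<ᵇ suc a)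
≡ᵇ-as-range zero    zero    = refl
≡ᵇ-as-range zero    (suc j) = refl
≡ᵇ-as-range (suc a) zero    = refl
≡ᵇ-as-range (suc a) (suc j) = ≡ᵇ-as-range a j

sum-point : ∀ n a (f : ℕ → ℚ) → a ℕ.< n → sumFrom 0 n (λ j → 𝟙 (a ℕ.≡ᵇ j) * f j) ≡ f a
sum-point n a f a<n = begin
  sumFrom 0 n (λ j → 𝟙 (a ℕ.≡ᵇ j) * f j)
    ≡⟨ sumFrom-cong 0 n (λ j _ _ → cong (λ b → 𝟙 b * f j) (≡ᵇ-as-range a j)) ⟩
  sumFrom 0 n (λ j → 𝟙 ((a ℕ.<ᵇ suc j) ∧ (j ℕ.<ᵇ suc a)) * f j)
    ≡⟨ sum-range n a (suc a) f (ℕ.n≤1+n a) a<n ⟩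
  sumFrom a (suc a ∸ a) f
    ≡⟨ cong (λ k → sumFrom a k f) (ℕ.m+n∸n≡m 1 a) ⟩
  f a + 0ℚ
    ≡⟨ ℚ.+-identityʳ (f a) ⟩
  f a
    ∎
  where open ≡-Reasoning

sum-guarded-point : ∀ n a c (f : ℕ → ℚ) → (T c → a ℕ.< n) →
  sumFrom 0 n (λ j → 𝟙 (c ∧ (a ℕ.≡ᵇ j)) * f j) ≡ c ⁇ f a
sum-guarded-point n a true  f a<n = sum-point n a f (a<n _)
sum-guarded-point n a false f _   = sum-guarded n false (a ℕ.≡ᵇ_) f

sum-tail : ∀ n lo (f : ℕ → ℚ) → lo ℕ.≤ n →
  sumFrom 0 n (λ j → 𝟙 (lo ℕ.<ᵇ suc j) * f j) ≡ sumFrom lo (n ∸ lo) f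
sum-tail n lo f lo≤n = trans (sumFrom-cong 0 n λ j _ j<n → cong (λ b → 𝟙 b * f j) (sym (below-n j j<n)))
                             (sum-range n lo n f lo≤n ℕ.≤-refl)
  where
  below-n : ∀ j → j ℕ.< n → (lo ℕ.<ᵇ suc j) ∧ (j ℕ.<ᵇ n) ≡ (lo ℕ.<ᵇ suc j)
  below-n j j<n = trans (cong ((lo ℕ.<ᵇ suc j) ∧_) (<ᵇ-true j<n)) (∧-identityʳ (lo ℕ.<ᵇ suc j))

∧-left : ∀ x {y} → T (x ∧ y) → T x
∧-left true _ = _

∧-right : ∀ x {y} → T (x ∧ y) → T y
∧-right true t = t

∨-cases : ∀ x {y} → T (x ∨ y) → T x ⊎ T y
∨-cases true  _ = inj₁ _
∨-cases false t = inj₂ t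

sum-∨ : ∀ n (x y : ℕ → Bool) (f : ℕ → ℚ) → (∀ j → T (x j) → ¬ T (y j)) →
  sumFrom 0 n (λ j → 𝟙 (x j ∨ y j) * f j)
    ≡ sumFrom 0 n (λ j → 𝟙 (x j) * f j) + sumFrom 0 n (λ j → 𝟙 (y j) * f j)
sum-∨ n x y f disjoint =
  trans (sumFrom-cong 0 n λ j _ _ → 𝟙-∨-* (x j) (y j) (f j) (disjoint j)) (sumFrom-+ 0 n _ _)
  where
  𝟙-∨-* : ∀ a b v → (T a → ¬ T b) → 𝟙 (a ∨ b) * v ≡ 𝟙 a * v + 𝟙 b * v
  𝟙-∨-* false b     v _ = sym (trans (cong (_+ 𝟙 b * v) (ℚ.*-zeroˡ v)) (ℚ.+-identityˡ _))
  𝟙-∨-* true  false v _ = sym (trans (cong (1ℚ * v +_) (ℚ.*-zeroˡ v)) (ℚ.+-identityʳ _))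
  𝟙-∨-* true  true  v a⇒¬b = ⊥-elim (a⇒¬b _ _)

≡ᵇ-sym : ∀ a j → (a ℕ.≡ᵇ j) ≡ (j ℕ.≡ᵇ a)
≡ᵇ-sym zero    zero    = refl
≡ᵇ-sym zero    (suc j) = refl
≡ᵇ-sym (suc a) zero    = refl
≡ᵇ-sym (suc a) (suc j) = ≡ᵇ-sym a j

≡ᵇ-∧-swap : ∀ a j c → (j ℕ.≡ᵇ a) ∧ c ≡ c ∧ (a ℕ.≡ᵇ j)
≡ᵇ-∧-swap a j c = trans (∧-comm _ c) (cong (c ∧_) (≡ᵇ-sym j a))

≡ᵇ-∧-subst : ∀ a j (c : ℕ → Bool) → (a ℕ.≡ᵇ j) ∧ c j ≡ c a ∧ (a ℕ.≡ᵇ j)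
≡ᵇ-∧-subst a j c with a ℕ.≡ᵇ j in eq
... | true  rewrite ℕ.≡ᵇ⇒≡ a j (Equivalence.from T-≡ eq) = sym (∧-identityʳ (c j))
... | false = sym (∧-zeroʳ (c a))

-- The double broom

-- Vertices 0 … e form the path, p … q − 1 are the leaves at 0 and q … n − 1 the leaves at e;
-- broomDir n d i j unfolds to pathEdge i j ∨ leftEdge i j ∨ rightEdge i j.
module Broom (n e : ℕ) (3+e≤n : 3 ℕ.+ e ℕ.≤ n) where
  d p L q R : ℕ
  d = suc (suc e)
  p = suc e
  L = broomℓ n d
  q = p ℕ.+ L
  R = n ∸ q

  p≤n : p ℕ.≤ n
  p≤n = ℕ.≤-trans (ℕ.n≤1+n p) (ℕ.≤-trans (ℕ.n≤1+n (suc p)) 3+e≤n)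

  p≤q : p ℕ.≤ q
  p≤q = ℕ.m≤m+n p L

  q≤n : q ℕ.≤ n
  q≤n = ℕ.≤-trans (ℕ.+-monoʳ-≤ p (ℕ.m/n≤m (n ∸ p) 2)) (ℕ.≤-reflexive (ℕ.m+[n∸m]≡n p≤n))

  e<n : e ℕ.< n
  e<n = p≤n

  Lℤ Rℤ eℤ edges : ℤ
  Lℤ = ℤ.+ L
  Rℤ = ℤ.+ R
  eℤ = ℤ.+ e
  edges = eℤ ℤ.+ Lℤ ℤ.+ Rℤ

  Φ : ℤ → ℤ
  Φ = Polynomial.Φ6 Lℤ Rℤ eℤ

  pathEdge leftEdge rightEdge : ℕ → ℕ → Bool
  pathEdge  i j = (suc i ℕ.≡ᵇ j) ∧ (j ℕ.<ᵇ p)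
  leftEdge  i j = (i ℕ.≡ᵇ 0) ∧ ((p ℕ.<ᵇ suc j) ∧ (j ℕ.<ᵇ q))
  rightEdge i j = (i ℕ.≡ᵇ e) ∧ (q ℕ.<ᵇ suc j)

  adj : ℕ → ℕ → Bool
  adj i j = broomDir n d i j ∨ broomDir n d j i

  neighbourSum : (ℕ → ℚ) → ℕ → ℚ
  neighbourSum f i = sumFrom 0 n (λ j → 𝟙 (adj i j) * f j)

  before : (ℕ → ℚ) → ℕ → ℚ
  before f zero    = 0ℚ
  before f (suc i) = f i

  isLeftLeaf : ℕ → Bool
  isLeftLeaf i = (p ℕ.<ᵇ suc i) ∧ (i ℕ.<ᵇ q)

  private
    pathEdge-ends : ∀ i j → T (pathEdge i j) → suc i ≡ j × j ℕ.< p
    pathEdge-ends i j edge = ℕ.≡ᵇ⇒≡ (suc i) j (∧-left (suc i ℕ.≡ᵇ j) edge)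
                           , ℕ.<ᵇ⇒< j p (∧-right (suc i ℕ.≡ᵇ j) edge)

    leftEdge-ends : ∀ i j → T (leftEdge i j) → i ≡ 0 × p ℕ.≤ j × j ℕ.< q
    leftEdge-ends i j edge = ℕ.≡ᵇ⇒≡ i 0 (∧-left (i ℕ.≡ᵇ 0) edge)
                           , ℕ.s≤s⁻¹ (ℕ.<ᵇ⇒< p (suc j) (∧-left (p ℕ.<ᵇ suc j) leaf))
                           , ℕ.<ᵇ⇒< j q (∧-right (p ℕ.<ᵇ suc j) leaf)
      where leaf = ∧-right (i ℕ.≡ᵇ 0) edge

    rightEdge-ends : ∀ i j → T (rightEdge i j) → i ≡ e × q ℕ.≤ j
    rightEdge-ends i j edge = ℕ.≡ᵇ⇒≡ i e (∧-left (i ℕ.≡ᵇ e) edge)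
                            , ℕ.s≤s⁻¹ (ℕ.<ᵇ⇒< q (suc j) (∧-right (i ℕ.≡ᵇ e) edge))

    broomDir-< : ∀ i j → T (broomDir n d i j) → i ℕ.< j
    broomDir-< i j edge with ∨-cases (pathEdge i j) edge
    ... | inj₁ path with pathEdge-ends i j path
    ...   | i+1≡j , _ = ℕ.≤-reflexive i+1≡j
    broomDir-< i j edge | inj₂ leaf with ∨-cases (leftEdge i j) leaf
    ... | inj₁ left with leftEdge-ends i j left
    ...   | refl , p≤j , _ = ℕ.<-≤-trans ℕ.z<s p≤j
    broomDir-< i j edge | inj₂ leaf | inj₂ right with rightEdge-ends i j right
    ...   | refl , q≤j = ℕ.≤-trans p≤q q≤j

    sum-pathEdge : ∀ f i → sumFrom 0 n (λ j → 𝟙 (pathEdge i j) * f j) ≡ (suc i ℕ.<ᵇ p) ⁇ f (suc i)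
    sum-pathEdge f i = trans
      (sumFrom-cong 0 n λ j _ _ → cong (λ b → 𝟙 b * f j) (≡ᵇ-∧-subst (suc i) j (ℕ._<ᵇ p)))
      (sum-guarded-point n (suc i) _ f λ i<p → ℕ.<-≤-trans (ℕ.<ᵇ⇒< (suc i) p i<p) p≤n)

    sum-leftEdge : ∀ f i → sumFrom 0 n (λ j → 𝟙 (leftEdge i j) * f j) ≡ (i ℕ.≡ᵇ 0) ⁇ sumFrom p L f
    sum-leftEdge f i = trans (sum-guarded n (i ℕ.≡ᵇ 0) isLeftLeaf f)
      (cong ((i ℕ.≡ᵇ 0) ⁇_) (trans (sum-range n p q f p≤q q≤n)
                                   (cong (λ k → sumFrom p k f) (ℕ.m+n∸m≡n p L))))

    sum-rightEdge : ∀ f i → sumFrom 0 n (λ j → 𝟙 (rightEdge i j) * f j) ≡ (i ℕ.≡ᵇ e) ⁇ sumFrom q R f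
    sum-rightEdge f i = trans (sum-guarded n (i ℕ.≡ᵇ e) (λ j → q ℕ.<ᵇ suc j) f)
      (cong ((i ℕ.≡ᵇ e) ⁇_) (sum-tail n q f q≤n))

    sum-pathEdge⁻ : ∀ f i → sumFrom 0 n (λ j → 𝟙 (pathEdge j i) * f j) ≡ (i ℕ.<ᵇ p) ⁇ before f i
    sum-pathEdge⁻ f zero    = sumFrom-zero 0 n λ j _ _ → ℚ.*-zeroˡ (f j)
    sum-pathEdge⁻ f (suc i) = trans
      (sumFrom-cong 0 n λ j _ _ → cong (λ b → 𝟙 b * f j) (≡ᵇ-∧-swap i j (suc i ℕ.<ᵇ p)))
      (sum-guarded-point n i _ f λ i<p → ℕ.<-trans (ℕ.n<1+n i) (ℕ.<-≤-trans (ℕ.<ᵇ⇒< (suc i) p i<p) p≤n))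

    sum-leftEdge⁻ : ∀ f i → sumFrom 0 n (λ j → 𝟙 (leftEdge j i) * f j) ≡ isLeftLeaf i ⁇ f 0
    sum-leftEdge⁻ f i = trans
      (sumFrom-cong 0 n λ j _ _ → cong (λ b → 𝟙 b * f j) (≡ᵇ-∧-swap 0 j (isLeftLeaf i)))
      (sum-guarded-point n 0 _ f λ _ → ℕ.<-≤-trans ℕ.z<s p≤n)

    sum-rightEdge⁻ : ∀ f i → sumFrom 0 n (λ j → 𝟙 (rightEdge j i) * f j) ≡ (q ℕ.<ᵇ suc i) ⁇ f e
    sum-rightEdge⁻ f i = trans
      (sumFrom-cong 0 n λ j _ _ → cong (λ b → 𝟙 b * f j) (≡ᵇ-∧-swap e j (q ℕ.<ᵇ suc i)))
      (sum-guarded-point n e _ f λ _ → e<n)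

    path-not-leaf : ∀ i j → T (pathEdge i j) → ¬ T (leftEdge i j ∨ rightEdge i j)
    path-not-leaf i j path leaf with proj₂ (pathEdge-ends i j path) | ∨-cases (leftEdge i j) leaf
    ... | j<p | inj₁ left  = ℕ.<⇒≱ j<p (proj₁ (proj₂ (leftEdge-ends i j left)))
    ... | j<p | inj₂ right = ℕ.<⇒≱ (ℕ.<-≤-trans j<p p≤q) (proj₂ (rightEdge-ends i j right))

    left-not-right : ∀ i j → T (leftEdge i j) → ¬ T (rightEdge i j)
    left-not-right i j left right = ℕ.<⇒≱ (proj₂ (proj₂ (leftEdge-ends i j left))) (proj₂ (rightEdge-ends i j right))

  neighbourSum-formula : ∀ f i → neighbourSum f i ≡
      ((suc i ℕ.<ᵇ p) ⁇ f (suc i) + ((i ℕ.≡ᵇ 0) ⁇ sumFrom p L f + (i ℕ.≡ᵇ e) ⁇ sumFrom q R f))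
    + ((i ℕ.<ᵇ p) ⁇ before f i + (isLeftLeaf i ⁇ f 0 + (q ℕ.<ᵇ suc i) ⁇ f e))
  neighbourSum-formula f i = trans
    (sum-∨ n (broomDir n d i) (λ j → broomDir n d j i) f
           (λ j i→j j→i → ℕ.<-asym (broomDir-< i j i→j) (broomDir-< j i j→i)))
    (cong₂ _+_ outgoing incoming)
    where
    outgoing = trans (sum-∨ n (pathEdge i) _ f (path-not-leaf i)) (cong₂ _+_ (sum-pathEdge f i)
      (trans (sum-∨ n (leftEdge i) (rightEdge i) f (left-not-right i))
             (cong₂ _+_ (sum-leftEdge f i) (sum-rightEdge f i))))
    incoming = trans (sum-∨ n (λ j → pathEdge j i) _ f (λ j → path-not-leaf j i)) (cong₂ _+_ (sum-pathEdge⁻ f i)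
      (trans (sum-∨ n (λ j → leftEdge j i) (λ j → rightEdge j i) f (λ j → left-not-right j i))
             (cong₂ _+_ (sum-leftEdge⁻ f i) (sum-rightEdge⁻ f i))))

  neighbourSum-eval : ∀ f i {b₁ b₂ b₃ b₄ b₅ b₆} →
    (suc i ℕ.<ᵇ p) ≡ b₁ → (i ℕ.≡ᵇ 0) ≡ b₂ → (i ℕ.≡ᵇ e) ≡ b₃ →
    (i ℕ.<ᵇ p) ≡ b₄ → isLeftLeaf i ≡ b₅ → (q ℕ.<ᵇ suc i) ≡ b₆ →
    neighbourSum f i ≡ (b₁ ⁇ f (suc i) + (b₂ ⁇ sumFrom p L f + b₃ ⁇ sumFrom q R f))
                     + (b₄ ⁇ before f i + (b₅ ⁇ f 0 + b₆ ⁇ f e))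
  neighbourSum-eval f i refl refl refl refl refl refl = neighbourSum-formula f i

  neighbourSum-leftLeaf : ∀ f i → p ℕ.≤ i → i ℕ.< q → neighbourSum f i ≡ f 0
  neighbourSum-leftLeaf f i p≤i i<q = trans
    (neighbourSum-eval f i
      (<ᵇ-false (ℕ.m≤n⇒m≤1+n p≤i))
      (≡ᵇ-false (ℕ.>⇒≢ (ℕ.<-≤-trans ℕ.z<s p≤i)))
      (≡ᵇ-false (ℕ.>⇒≢ p≤i))
      (<ᵇ-false p≤i)
      (cong₂ _∧_ (<ᵇ-true (ℕ.s≤s p≤i)) (<ᵇ-true i<q))
      (<ᵇ-false i<q))
    (trans (ℚ.+-identityˡ _) (trans (ℚ.+-identityˡ _) (ℚ.+-identityʳ _)))

  neighbourSum-rightLeaf : ∀ f i → q ℕ.≤ i → neighbourSum f i ≡ f e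
  neighbourSum-rightLeaf f i q≤i = trans
    (neighbourSum-eval f i
      (<ᵇ-false (ℕ.m≤n⇒m≤1+n p≤i))
      (≡ᵇ-false (ℕ.>⇒≢ (ℕ.<-≤-trans ℕ.z<s p≤i)))
      (≡ᵇ-false (ℕ.>⇒≢ p≤i))
      (<ᵇ-false p≤i)
      (trans (cong ((p ℕ.<ᵇ suc i) ∧_) (<ᵇ-false q≤i)) (∧-zeroʳ (p ℕ.<ᵇ suc i)))
      (<ᵇ-true (ℕ.s≤s q≤i)))
    (trans (ℚ.+-identityˡ _) (trans (ℚ.+-identityˡ _) (ℚ.+-identityˡ _)))
    where p≤i = ℕ.≤-trans p≤q q≤i

  neighbourSum-inner : ∀ f i → suc (suc i) ℕ.< p → neighbourSum f (suc i) ≡ f (suc (suc i)) + f i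
  neighbourSum-inner f i i+2<p = trans
    (neighbourSum-eval f (suc i) {true} {false} {false} {true} {false} {false}
      (<ᵇ-true i+2<p)
      refl
      (≡ᵇ-false (ℕ.<⇒≢ (ℕ.s≤s⁻¹ i+2<p)))
      (<ᵇ-true (ℕ.<-trans (ℕ.n<1+n (suc i)) i+2<p))
      (cong (_∧ (suc i ℕ.<ᵇ q)) (<ᵇ-false (ℕ.<⇒≤ i+2<p)))
      (<ᵇ-false (ℕ.≤-trans (ℕ.<⇒≤ i+2<p) p≤q)))
    (cong₂ _+_ (ℚ.+-identityʳ (f (suc (suc i)))) (ℚ.+-identityʳ (f i)))

  neighbourSum-first : ∀ f → 0 ℕ.< e → neighbourSum f 0 ≡ f 1 + sumFrom p L f
  neighbourSum-first f 0<e = trans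
    (neighbourSum-eval f 0 {true} {true} {false} {true} {false} {false}
      (<ᵇ-true (ℕ.s≤s 0<e))
      refl
      (≡ᵇ-false (ℕ.<⇒≢ 0<e))
      refl
      refl
      (<ᵇ-false (ℕ.≤-trans (ℕ.s≤s ℕ.z≤n) p≤q)))
    (trans (ℚ.+-identityʳ (f 1 + (sumFrom p L f + 0ℚ))) (cong (f 1 +_) (ℚ.+-identityʳ (sumFrom p L f))))

  neighbourSum-last : ∀ f i → suc i ≡ e → neighbourSum f (suc i) ≡ f i + sumFrom q R f
  neighbourSum-last f i i+1≡e = trans
    (neighbourSum-eval f (suc i) {false} {false} {true} {true} {false} {false}
      (<ᵇ-false (ℕ.≤-reflexive (cong suc (sym i+1≡e))))
      refl
      (≡ᵇ-true i+1≡e)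
      (<ᵇ-true i+1<p)
      (cong (_∧ (suc i ℕ.<ᵇ q)) (<ᵇ-false i+1<p))
      (<ᵇ-false (ℕ.≤-trans i+1<p p≤q)))
    (trans (cong₂ _+_ (trans (ℚ.+-identityˡ _) (ℚ.+-identityˡ (sumFrom q R f))) (ℚ.+-identityʳ (f i)))
           (ℚ.+-comm (sumFrom q R f) (f i)))
    where
    i+1<p : suc i ℕ.< p
    i+1<p = ℕ.≤-reflexive (cong suc i+1≡e)

  neighbourSum-star : ∀ f → e ≡ 0 → neighbourSum f 0 ≡ sumFrom p L f + sumFrom q R f
  neighbourSum-star f e≡0 = trans
    (neighbourSum-eval f 0 {false} {true} {true} {true} {false} {false}
      (<ᵇ-false (ℕ.≤-reflexive (cong suc e≡0)))
      refl
      (≡ᵇ-true (sym e≡0))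
      refl
      refl
      (<ᵇ-false (ℕ.≤-trans (ℕ.s≤s ℕ.z≤n) p≤q)))
    (trans (ℚ.+-identityʳ (0ℚ + (sumFrom p L f + sumFrom q R f))) (ℚ.+-identityˡ _))

-- Algebra of the first-step equations

first-step-solve : ∀ K C {x y S : ℚ} → let D = ℤ.+ 1 ℤ.+ K in
  ℤ→ℚ D * x ≡ ℤ→ℚ D + (y + S) → S ≡ ℤ→ℚ K * x + ℤ→ℚ C → x ≡ y + ℤ→ℚ (D ℤ.+ C)
first-step-solve K C {x} {y} {S} balance S≡ = begin
  x                                       ≡⟨ cancel-degree x k ⟩
  (1ℚ + k) * x - k * x                    ≡⟨ cong (λ d → d * x - k * x) (ℤ→ℚ-1+ K) ⟨
  d * x - k * x                           ≡⟨ cong (_- k * x) balance ⟩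
  d + (y + S) - k * x                     ≡⟨ cong (λ s → d + (y + s) - k * x) S≡ ⟩
  d + (y + (k * x + c)) - k * x           ≡⟨ collect d y k x c ⟩
  y + (d + c)                             ≡⟨ cong (y +_) (ℤ→ℚ-homo-+ D C) ⟨
  y + ℤ→ℚ (D ℤ.+ C)                      ∎
  where
  open ≡-Reasoning
  open +-*-Solver
  D = ℤ.+ 1 ℤ.+ K
  d = ℤ→ℚ D
  k = ℤ→ℚ K
  c = ℤ→ℚ C
  cancel-degree : ∀ x k → x ≡ (1ℚ + k) * x - k * x
  cancel-degree = solve 2 (λ x k → x := (con 1ℚ :+ k) :* x :- k :* x) refl
  collect : ∀ d y k x c → d + (y + (k * x + c)) - k * x ≡ y + (d + c)
  collect = solve 5 (λ d y k x c → d :+ (y :+ (k :* x :+ c)) :- k :* x := y :+ (d :+ c)) refl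

*-1+ : ∀ a x → a * (1ℚ + x) ≡ a * x + a
*-1+ a x = trans (ℚ.*-distribˡ-+ a 1ℚ x)
  (trans (ℚ.+-comm (a * 1ℚ) (a * x)) (cong (a * x +_) (ℚ.*-identityʳ a)))

ℤ→ℚ-weightedProfile : ∀ L R εL εR x y S₁ S₂ →
  (ℤ→ℚ L - 1ℚ) * ℤ→ℚ x + (ℤ→ℚ R - 1ℚ) * ℤ→ℚ y + ℤ→ℚ (ℤ.+ 2) * (ℤ→ℚ S₁ + ℤ→ℚ S₂)
    + ℤ→ℚ (L ℤ.- εL) * (1ℚ + ℤ→ℚ x) + ℤ→ℚ (R ℤ.- εR) * (1ℚ + ℤ→ℚ y)
  ≡ ℤ→ℚ ((L ℤ.- ℤ.+ 1) ℤ.* x ℤ.+ (R ℤ.- ℤ.+ 1) ℤ.* y ℤ.+ ℤ.+ 2 ℤ.* (S₁ ℤ.+ S₂)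
         ℤ.+ (L ℤ.- εL) ℤ.* (ℤ.+ 1 ℤ.+ x) ℤ.+ (R ℤ.- εR) ℤ.* (ℤ.+ 1 ℤ.+ y))
ℤ→ℚ-weightedProfile L R εL εR x y S₁ S₂ = sym (begin
  ℤ→ℚ (A ℤ.+ B ℤ.+ C ℤ.+ D ℤ.+ E)
    ≡⟨ ℤ→ℚ-homo-+ (A ℤ.+ B ℤ.+ C ℤ.+ D) E ⟩
  ℤ→ℚ (A ℤ.+ B ℤ.+ C ℤ.+ D) + ℤ→ℚ E
    ≡⟨ cong (_+ ℤ→ℚ E) (ℤ→ℚ-homo-+ (A ℤ.+ B ℤ.+ C) D) ⟩
  ℤ→ℚ (A ℤ.+ B ℤ.+ C) + ℤ→ℚ D + ℤ→ℚ E
    ≡⟨ cong (λ z → z + ℤ→ℚ D + ℤ→ℚ E) (ℤ→ℚ-homo-+ (A ℤ.+ B) C) ⟩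
  ℤ→ℚ (A ℤ.+ B) + ℤ→ℚ C + ℤ→ℚ D + ℤ→ℚ E
    ≡⟨ cong (λ z → z + ℤ→ℚ C + ℤ→ℚ D + ℤ→ℚ E) (ℤ→ℚ-homo-+ A B) ⟩
  ℤ→ℚ A + ℤ→ℚ B + ℤ→ℚ C + ℤ→ℚ D + ℤ→ℚ E
    ≡⟨ cong₂ _+_ (cong₂ _+_ (cong₂ _+_ (cong₂ _+_ (less-one L x) (less-one R y)) twice) (one-more L εL x))
                 (one-more R εR y) ⟩
  A′ + B′ + C′ + D′ + E′
    ∎)
  where
  open ≡-Reasoning
  A = (L ℤ.- ℤ.+ 1) ℤ.* x
  B = (R ℤ.- ℤ.+ 1) ℤ.* y
  C = ℤ.+ 2 ℤ.* (S₁ ℤ.+ S₂)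
  D = (L ℤ.- εL) ℤ.* (ℤ.+ 1 ℤ.+ x)
  E = (R ℤ.- εR) ℤ.* (ℤ.+ 1 ℤ.+ y)
  A′ = (ℤ→ℚ L - 1ℚ) * ℤ→ℚ x
  B′ = (ℤ→ℚ R - 1ℚ) * ℤ→ℚ y
  C′ = ℤ→ℚ (ℤ.+ 2) * (ℤ→ℚ S₁ + ℤ→ℚ S₂)
  D′ = ℤ→ℚ (L ℤ.- εL) * (1ℚ + ℤ→ℚ x)
  E′ = ℤ→ℚ (R ℤ.- εR) * (1ℚ + ℤ→ℚ y)
  twice : ℤ→ℚ C ≡ C′
  twice = trans (ℤ→ℚ-homo-* (ℤ.+ 2) (S₁ ℤ.+ S₂)) (cong (ℤ→ℚ (ℤ.+ 2) *_) (ℤ→ℚ-homo-+ S₁ S₂))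
  less-one : ∀ K z → ℤ→ℚ ((K ℤ.- ℤ.+ 1) ℤ.* z) ≡ (ℤ→ℚ K - 1ℚ) * ℤ→ℚ z
  less-one K z = trans (ℤ→ℚ-homo-* (K ℤ.- ℤ.+ 1) z) (cong (_* ℤ→ℚ z) (ℤ→ℚ-homo-− K (ℤ.+ 1)))
  one-more : ∀ K ε z → ℤ→ℚ ((K ℤ.- ε) ℤ.* (ℤ.+ 1 ℤ.+ z)) ≡ ℤ→ℚ (K ℤ.- ε) * (1ℚ + ℤ→ℚ z)
  one-more K ε z = trans (ℤ→ℚ-homo-* (K ℤ.- ε) (ℤ.+ 1 ℤ.+ z)) (cong (ℤ→ℚ (K ℤ.- ε) *_) (ℤ→ℚ-1+ z))

anchor-neighbours : ∀ (A r : ℤ) x →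
  (x + ℤ→ℚ r) + (ℤ→ℚ A - 1ℚ) * (1ℚ + x) ≡ ℤ→ℚ A * x + ℤ→ℚ (r ℤ.+ (A ℤ.- ℤ.+ 1))
anchor-neighbours A r x = begin
  (x + ℤ→ℚ r) + (ℤ→ℚ A - 1ℚ) * (1ℚ + x)
    ≡⟨ regroup x (ℤ→ℚ r) (ℤ→ℚ A) ⟩
  ℤ→ℚ A * x + (ℤ→ℚ r + (ℤ→ℚ A - 1ℚ))
    ≡⟨ cong (λ z → ℤ→ℚ A * x + (ℤ→ℚ r + z)) (ℤ→ℚ-homo-− A (ℤ.+ 1)) ⟨
  ℤ→ℚ A * x + (ℤ→ℚ r + ℤ→ℚ (A ℤ.- ℤ.+ 1))
    ≡⟨ cong (ℤ→ℚ A * x +_) (ℤ→ℚ-homo-+ r (A ℤ.- ℤ.+ 1)) ⟨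
  ℤ→ℚ A * x + ℤ→ℚ (r ℤ.+ (A ℤ.- ℤ.+ 1))
    ∎
  where
  open ≡-Reasoning
  open +-*-Solver
  regroup : ∀ x r A → (x + r) + (A - 1ℚ) * (1ℚ + x) ≡ A * x + (r + (A - 1ℚ))
  regroup = solve 3 (λ x r A → (x :+ r) :+ (A :- con 1ℚ) :* (con 1ℚ :+ x) := A :* x :+ (r :+ (A :- con 1ℚ))) refl

path-weighted-sum : ∀ e (w g : ℕ → ℚ) (A B : ℚ) →
  (e ≡ 0 → w 0 ≡ A + B) → (0 ℕ.< e → w 0 ≡ 1ℚ + A) → (∀ i → suc i ≡ e → w (suc i) ≡ 1ℚ + B) →
  (∀ i → suc (suc i) ℕ.< suc e → w (suc i) ≡ ℤ→ℚ (ℤ.+ 2)) →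
  sumFrom 0 (suc e) (λ j → w j * g j) ≡ (A - 1ℚ) * g 0 + (B - 1ℚ) * g e + ℤ→ℚ (ℤ.+ 2) * sumFrom 0 (suc e) g
path-weighted-sum zero w g A B w-star _ _ _ =
  trans (cong (λ x → x * g 0 + 0ℚ) (w-star refl)) (star (g 0) A B)
  where
  open +-*-Solver
  star : ∀ x A B → (A + B) * x + 0ℚ ≡ (A - 1ℚ) * x + (B - 1ℚ) * x + ℤ→ℚ (ℤ.+ 2) * (x + 0ℚ)
  star = solve 3 (λ x A B → (A :+ B) :* x :+ con 0ℚ
                          := (A :- con 1ℚ) :* x :+ (B :- con 1ℚ) :* x :+ con (ℤ→ℚ (ℤ.+ 2)) :* (x :+ con 0ℚ)) refl
path-weighted-sum (suc e) w g A B _ w-first w-last w-inner = begin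
  w 0 * g 0 + sumFrom 1 (suc e) wg
    ≡⟨ cong₂ _+_ (cong (_* g 0) (w-first ℕ.z<s)) (sumFrom-last 1 e wg) ⟩
  (1ℚ + A) * g 0 + (sumFrom 1 e wg + w (suc e) * g (suc e))
    ≡⟨ cong₂ (λ x y → (1ℚ + A) * g 0 + (x + y)) inner (cong (_* g (suc e)) (w-last e refl)) ⟩
  (1ℚ + A) * g 0 + (ℤ→ℚ (ℤ.+ 2) * sumFrom 1 e g + (1ℚ + B) * g (suc e))
    ≡⟨ regroup (g 0) (g (suc e)) (sumFrom 1 e g) A B ⟩
  (A - 1ℚ) * g 0 + (B - 1ℚ) * g (suc e) + ℤ→ℚ (ℤ.+ 2) * (g 0 + (sumFrom 1 e g + g (suc e)))
    ≡⟨ cong (λ x → (A - 1ℚ) * g 0 + (B - 1ℚ) * g (suc e) + ℤ→ℚ (ℤ.+ 2) * (g 0 + x)) (sumFrom-last 1 e g) ⟨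
  (A - 1ℚ) * g 0 + (B - 1ℚ) * g (suc e) + ℤ→ℚ (ℤ.+ 2) * sumFrom 0 (suc (suc e)) g
    ∎
  where
  open ≡-Reasoning
  open +-*-Solver
  wg = λ j → w j * g j
  inner : sumFrom 1 e wg ≡ ℤ→ℚ (ℤ.+ 2) * sumFrom 1 e g
  inner = trans (sumFrom-cong 1 e λ { (suc j) _ j<e → cong (_* g (suc j)) (w-inner j (ℕ.s≤s j<e)) })
                (sumFrom-*ˡ 1 e (ℤ→ℚ (ℤ.+ 2)) g)
  regroup : ∀ x y S A B → (1ℚ + A) * x + (ℤ→ℚ (ℤ.+ 2) * S + (1ℚ + B) * y)
                        ≡ (A - 1ℚ) * x + (B - 1ℚ) * y + ℤ→ℚ (ℤ.+ 2) * (x + (S + y))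
  regroup = solve 5 (λ x y S A B → (con 1ℚ :+ A) :* x :+ (con (ℤ→ℚ (ℤ.+ 2)) :* S :+ (con 1ℚ :+ B) :* y)
                                := (A :- con 1ℚ) :* x :+ (B :- con 1ℚ) :* y :+ con (ℤ→ℚ (ℤ.+ 2)) :* (x :+ (S :+ y))) refl

-- Hitting times towards a fixed target

module Walk (n e : ℕ) (3+e≤n : 3 ℕ.+ e ℕ.≤ n) (H : Fin n → Fin n → ℚ)
            (hit : IsHittingTime (DoubleBroom n (suc (suc e))) H) (v : Fin n) where
  open Broom n e 3+e≤n

  t : ℕ
  t = toℕ v

  -- h j is H(j, v) for j < n and junk (0) beyond.
  h : ℕ → ℚ
  h = extend (λ u → H u v)

  degree : ℕ → ℚ
  degree = neighbourSum (λ _ → 1ℚ)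

  ℕ→ℚ-deg : ∀ u → ℕ→ℚ (deg (DoubleBroom n d) u) ≡ degree (toℕ u)
  ℕ→ℚ-deg u = begin
    ℕ→ℚ (deg (DoubleBroom n d) u)                        ≡⟨ ℕ→ℚ-sumFinℕ n _ ⟩
    sumFin n (λ w → 𝟙 (adj (toℕ u) (toℕ w)))             ≡⟨ sumFin-sumFrom n 0 (𝟙 ∘ adj (toℕ u)) ⟩
    sumFrom 0 n (λ j → 𝟙 (adj (toℕ u) j))
      ≡⟨ sumFrom-cong 0 n (λ j _ _ → ℚ.*-identityʳ _) ⟨
    degree (toℕ u)                                        ∎
    where open ≡-Reasoning

  neighbourSum-h : ∀ (u : Fin n) → sumFin n (λ w → 𝟙 (adj (toℕ u) (toℕ w)) * H w v) ≡ neighbourSum h (toℕ u)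
  neighbourSum-h u = trans
    (sumFin-cong n λ w → cong (𝟙 (adj (toℕ u) (toℕ w)) *_) (sym (extend-toℕ (λ u′ → H u′ v) w)))
    (sumFin-sumFrom n 0 (λ j → 𝟙 (adj (toℕ u) j) * h j))

  h-target : h t ≡ 0ℚ
  h-target = trans (extend-toℕ (λ u → H u v) v) (proj₁ hit v)

  hitting-eq : ∀ i → i ℕ.< n → i ≢ t → degree i * h i ≡ degree i + neighbourSum h i
  hitting-eq i i<n i≢t = subst (λ j → degree j * h j ≡ degree j + neighbourSum h j) (Fin.toℕ-fromℕ< i<n) (begin
    degree (toℕ u) * h (toℕ u)
      ≡⟨ cong₂ _*_ (ℕ→ℚ-deg u) (sym (extend-toℕ (λ u′ → H u′ v) u)) ⟨
    ℕ→ℚ (deg (DoubleBroom n d) u) * H u v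
      ≡⟨ proj₂ hit u v u≢v ⟩
    ℕ→ℚ (deg (DoubleBroom n d) u) + sumFin n (λ w → 𝟙 (adj (toℕ u) (toℕ w)) * H w v)
      ≡⟨ cong₂ _+_ (ℕ→ℚ-deg u) (neighbourSum-h u) ⟩
    degree (toℕ u) + neighbourSum h (toℕ u)
      ∎)
    where
    open ≡-Reasoning
    u = Fin.fromℕ< i<n
    u≢v : u ≢ v
    u≢v u≡v = i≢t (trans (sym (Fin.toℕ-fromℕ< i<n)) (cong toℕ u≡v))

  open Polynomial using (leftVolume; rightVolume; leftProfile; rightProfile)

  0<n : 0 ℕ.< n
  0<n = ℕ.<-≤-trans ℕ.z<s p≤n

  vertex-balance : ∀ i → i ℕ.< n → i ≢ t → ∀ D {N} → degree i ≡ ℤ→ℚ D → neighbourSum h i ≡ N →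
                   ℤ→ℚ D * h i ≡ ℤ→ℚ D + N
  vertex-balance i i<n i≢t D {N} deg≡ nbr≡ = begin
    ℤ→ℚ D * h i                    ≡⟨ cong (_* h i) deg≡ ⟨
    degree i * h i                 ≡⟨ hitting-eq i i<n i≢t ⟩
    degree i + neighbourSum h i    ≡⟨ cong₂ _+_ deg≡ nbr≡ ⟩
    ℤ→ℚ D + N                      ∎
    where open ≡-Reasoning

  degree-leftLeaf : ∀ i → p ℕ.≤ i → i ℕ.< q → degree i ≡ 1ℚ
  degree-leftLeaf = neighbourSum-leftLeaf (λ _ → 1ℚ)

  degree-rightLeaf : ∀ i → q ℕ.≤ i → degree i ≡ 1ℚ
  degree-rightLeaf = neighbourSum-rightLeaf (λ _ → 1ℚ)

  degree-inner : ∀ i → suc (suc i) ℕ.< p → degree (suc i) ≡ ℤ→ℚ (ℤ.+ 1 ℤ.+ ℤ.+ 1)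
  degree-inner = neighbourSum-inner (λ _ → 1ℚ)

  degree-first : 0 ℕ.< e → degree 0 ≡ ℤ→ℚ (ℤ.+ 1 ℤ.+ Lℤ)
  degree-first 0<e = trans (neighbourSum-first (λ _ → 1ℚ) 0<e)
    (trans (cong (1ℚ +_) (sumFrom-ones p L)) (sym (ℤ→ℚ-1+ Lℤ)))

  degree-last : ∀ i → suc i ≡ e → degree (suc i) ≡ ℤ→ℚ (ℤ.+ 1 ℤ.+ Rℤ)
  degree-last i i+1≡e = trans (neighbourSum-last (λ _ → 1ℚ) i i+1≡e)
    (trans (cong (1ℚ +_) (sumFrom-ones q R)) (sym (ℤ→ℚ-1+ Rℤ)))

  leftLeaf-value : ∀ i → p ℕ.≤ i → i ℕ.< q → i ≢ t → h i ≡ 1ℚ + h 0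
  leftLeaf-value i p≤i i<q i≢t = trans (sym (ℚ.*-identityˡ (h i)))
    (vertex-balance i (ℕ.<-≤-trans i<q q≤n) i≢t (ℤ.+ 1) (degree-leftLeaf i p≤i i<q) (neighbourSum-leftLeaf h i p≤i i<q))

  rightLeaf-value : ∀ i → q ℕ.≤ i → i ℕ.< n → i ≢ t → h i ≡ 1ℚ + h e
  rightLeaf-value i q≤i i<n i≢t = trans (sym (ℚ.*-identityˡ (h i)))
    (vertex-balance i i<n i≢t (ℤ.+ 1) (degree-rightLeaf i q≤i) (neighbourSum-rightLeaf h i q≤i))

  q+R≡n : q ℕ.+ R ≡ n
  q+R≡n = ℕ.m+[n∸m]≡n q≤n

  leftLeaves-sum : t ℕ.< p ⊎ q ℕ.≤ t → sumFrom p L h ≡ ℕ→ℚ L * (1ℚ + h 0)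
  leftLeaves-sum notLeft = sumFrom-constant p L (1ℚ + h 0) λ j p≤j j<q →
    leftLeaf-value j p≤j j<q λ { refl → [ (λ t<p → ℕ.<⇒≱ t<p p≤j) , (λ q≤t → ℕ.<⇒≱ j<q q≤t) ] notLeft }

  leftLeaves-sum-target : p ℕ.≤ t → t ℕ.< q → sumFrom p L h ≡ (ℕ→ℚ L - 1ℚ) * (1ℚ + h 0)
  leftLeaves-sum-target p≤t t<q = sumFrom-constant-but-one p L t (1ℚ + h 0) p≤t t<q h-target leftLeaf-value

  rightLeaves-sum : t ℕ.< q → sumFrom q R h ≡ ℕ→ℚ R * (1ℚ + h e)
  rightLeaves-sum t<q = sumFrom-constant q R (1ℚ + h e) λ j q≤j j<n →
    rightLeaf-value j q≤j (subst (j ℕ.<_) q+R≡n j<n) λ { refl → ℕ.<⇒≱ t<q q≤j }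

  rightLeaves-sum-target : q ℕ.≤ t → sumFrom q R h ≡ (ℕ→ℚ R - 1ℚ) * (1ℚ + h e)
  rightLeaves-sum-target q≤t = sumFrom-constant-but-one q R t (1ℚ + h e) q≤t
    (subst (t ℕ.<_) (sym q+R≡n) (Fin.toℕ<n v)) h-target
    λ j q≤j j<n → rightLeaf-value j q≤j (subst (j ℕ.<_) q+R≡n j<n)

  leftward : ∀ i → i ℕ.< e → i ℕ.< t → t ℕ.< p ⊎ q ℕ.≤ t → h i ≡ h (suc i) + ℤ→ℚ (leftVolume Lℤ (ℤ.+ i))
  leftward zero 0<e 0<t notLeft = trans
    (first-step-solve Lℤ Lℤ {y = h 1}
      (vertex-balance 0 0<n (ℕ.<⇒≢ 0<t) (ℤ.+ 1 ℤ.+ Lℤ) (degree-first 0<e) (neighbourSum-first h 0<e))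
      (trans (leftLeaves-sum notLeft) (*-1+ (ℕ→ℚ L) (h 0))))
    (cong (λ z → h 1 + ℤ→ℚ z) (Polynomial.leftVolume-first Lℤ))
  leftward (suc i) i+1<e i+1<t notLeft = trans
    (first-step-solve (ℤ.+ 1) (leftVolume Lℤ (ℤ.+ i)) {y = h (suc (suc i))}
      (vertex-balance (suc i) (ℕ.<-trans i+1<e e<n) (ℕ.<⇒≢ i+1<t) (ℤ.+ 1 ℤ.+ ℤ.+ 1)
        (degree-inner i i+2<p) (neighbourSum-inner h i i+2<p))
      (trans (leftward i (ℕ.<-trans (ℕ.n<1+n i) i+1<e) (ℕ.<-trans (ℕ.n<1+n i) i+1<t) notLeft)
             (cong (_+ ℤ→ℚ (leftVolume Lℤ (ℤ.+ i))) (sym (ℚ.*-identityˡ (h (suc i)))))))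
    (cong (λ z → h (suc (suc i)) + ℤ→ℚ z) (Polynomial.leftVolume-next Lℤ (ℤ.+ i)))
    where
    i+2<p : suc (suc i) ℕ.< p
    i+2<p = ℕ.s≤s i+1<e

  rightward : ∀ k i → suc i ℕ.+ k ≡ e → t ℕ.≤ i ⊎ p ℕ.≤ t → t ℕ.< q →
              h (suc i) ≡ h i + ℤ→ℚ (rightVolume Rℤ eℤ (ℤ.+ i))
  rightward zero i i+1+0≡e away t<q = trans
    (first-step-solve Rℤ Rℤ {y = h i}
      (vertex-balance (suc i) (ℕ.<-≤-trans (ℕ.≤-reflexive (cong suc i+1≡e)) p≤n) i+1≢t (ℤ.+ 1 ℤ.+ Rℤ)
        (degree-last i i+1≡e) (neighbourSum-last h i i+1≡e))
      (trans (rightLeaves-sum t<q)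
             (trans (cong (λ j → ℕ→ℚ R * (1ℚ + h j)) (sym i+1≡e)) (*-1+ (ℕ→ℚ R) (h (suc i))))))
    (cong (λ z → h i + ℤ→ℚ z) (trans (Polynomial.rightVolume-last Rℤ (ℤ.+ i))
                                     (cong (λ j → rightVolume Rℤ (ℤ.+ j) (ℤ.+ i)) i+1≡e)))
    where
    i+1≡e : suc i ≡ e
    i+1≡e = trans (sym (ℕ.+-identityʳ (suc i))) i+1+0≡e
    i+1≢t : suc i ≢ t
    i+1≢t i+1≡t = [ (λ t≤i → ℕ.<⇒≱ (ℕ.≤-reflexive i+1≡t) t≤i)
                  , (λ p≤t → ℕ.<⇒≱ (ℕ.≤-reflexive (cong suc (trans (sym i+1≡t) i+1≡e))) p≤t) ] away
  rightward (suc k) i i+1+k+1≡e away t<q = trans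
    (first-step-solve (ℤ.+ 1) (rightVolume Rℤ eℤ (ℤ.+ suc i)) {y = h i}
      (vertex-balance (suc i) (ℕ.<-trans (ℕ.n<1+n (suc i)) (ℕ.<-≤-trans i+2<p p≤n)) i+1≢t (ℤ.+ 1 ℤ.+ ℤ.+ 1)
        (degree-inner i i+2<p)
        (trans (neighbourSum-inner h i i+2<p) (ℚ.+-comm (h (suc (suc i))) (h i))))
      (trans (rightward k (suc i) i+2+k≡e (Data.Sum.map (ℕ.m≤n⇒m≤1+n) (λ p≤t → p≤t) away) t<q)
             (cong (_+ ℤ→ℚ (rightVolume Rℤ eℤ (ℤ.+ suc i))) (sym (ℚ.*-identityˡ (h (suc i)))))))
    (cong (λ z → h i + ℤ→ℚ z) (Polynomial.rightVolume-next Rℤ eℤ (ℤ.+ i)))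
    where
    i+2+k≡e : suc (suc i) ℕ.+ k ≡ e
    i+2+k≡e = trans (sym (ℕ.+-suc (suc i) k)) i+1+k+1≡e
    i+2<p : suc (suc i) ℕ.< p
    i+2<p = ℕ.s≤s (subst (suc (suc i) ℕ.≤_) i+2+k≡e (ℕ.m≤m+n (suc (suc i)) k))
    i+1≢t : suc i ≢ t
    i+1≢t i+1≡t = [ (λ t≤i → ℕ.<⇒≱ (ℕ.≤-reflexive i+1≡t) t≤i)
                  , (λ p≤t → ℕ.<⇒≱ (subst (ℕ._< p) i+1≡t (ℕ.<-trans (ℕ.n<1+n (suc i)) i+2<p)) p≤t) ] away

  profile-left : ∀ a c → a ℕ.≤ e → a ℕ.≤ t → (0 ℕ.< a → t ℕ.< p ⊎ q ℕ.≤ t) → h a ≡ ℤ→ℚ c →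
                 ∀ i → i ℕ.≤ a → h i ≡ ℤ→ℚ (leftProfile Lℤ (ℤ.+ a) c (ℤ.+ i))
  profile-left a c a≤e a≤t notLeft ha i i≤a = from (a ∸ i) i (ℕ.m+[n∸m]≡n i≤a)
    where
    from : ∀ m i → i ℕ.+ m ≡ a → h i ≡ ℤ→ℚ (leftProfile Lℤ (ℤ.+ a) c (ℤ.+ i))
    from zero    i i+0≡a = subst (λ j → h j ≡ ℤ→ℚ (leftProfile Lℤ (ℤ.+ a) c (ℤ.+ j)))
      (trans (sym i+0≡a) (ℕ.+-identityʳ i))
      (trans ha (cong ℤ→ℚ (Polynomial.leftProfile-anchor Lℤ (ℤ.+ a) c)))
    from (suc m) i i+m+1≡a = begin
      h i
        ≡⟨ leftward i (ℕ.<-≤-trans i<a a≤e) (ℕ.<-≤-trans i<a a≤t) (notLeft (ℕ.≤-<-trans ℕ.z≤n i<a)) ⟩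
      h (suc i) + ℤ→ℚ (leftVolume Lℤ (ℤ.+ i))
        ≡⟨ cong (_+ ℤ→ℚ (leftVolume Lℤ (ℤ.+ i))) (from m (suc i) (trans (sym (ℕ.+-suc i m)) i+m+1≡a)) ⟩
      ℤ→ℚ (leftProfile Lℤ (ℤ.+ a) c (ℤ.+ suc i)) + ℤ→ℚ (leftVolume Lℤ (ℤ.+ i))
        ≡⟨ ℤ→ℚ-homo-+ (leftProfile Lℤ (ℤ.+ a) c (ℤ.+ suc i)) (leftVolume Lℤ (ℤ.+ i)) ⟨
      ℤ→ℚ (leftProfile Lℤ (ℤ.+ a) c (ℤ.+ suc i) ℤ.+ leftVolume Lℤ (ℤ.+ i))
        ≡⟨ cong ℤ→ℚ (Polynomial.leftProfile-step Lℤ (ℤ.+ a) c (ℤ.+ i)) ⟨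
      ℤ→ℚ (leftProfile Lℤ (ℤ.+ a) c (ℤ.+ i))
        ∎
      where
      open ≡-Reasoning
      i<a : i ℕ.< a
      i<a = subst (i ℕ.<_) i+m+1≡a (ℕ.m<m+n i ℕ.z<s)

  profile-right : ∀ a c → (a ℕ.< e → (t ℕ.≤ a ⊎ p ℕ.≤ t) × t ℕ.< q) → h a ≡ ℤ→ℚ c →
                  ∀ k → a ℕ.+ k ℕ.≤ e → h (a ℕ.+ k) ≡ ℤ→ℚ (rightProfile Rℤ eℤ (ℤ.+ a) c (ℤ.+ k))
  profile-right a c clear ha zero _ = trans (cong h (ℕ.+-identityʳ a))
    (trans ha (cong ℤ→ℚ (Polynomial.rightProfile-anchor Rℤ eℤ (ℤ.+ a) c)))
  profile-right a c clear ha (suc k) a+k+1≤e = begin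
    h (a ℕ.+ suc k)
      ≡⟨ cong h (ℕ.+-suc a k) ⟩
    h (suc (a ℕ.+ k))
      ≡⟨ rightward (e ∸ suc (a ℕ.+ k)) (a ℕ.+ k) (ℕ.m+[n∸m]≡n a+k<e) away′ (proj₂ (clear a<e)) ⟩
    h (a ℕ.+ k) + ℤ→ℚ (rightVolume Rℤ eℤ (ℤ.+ (a ℕ.+ k)))
      ≡⟨ cong (_+ ℤ→ℚ (rightVolume Rℤ eℤ (ℤ.+ (a ℕ.+ k)))) (profile-right a c clear ha k (ℕ.<⇒≤ a+k<e)) ⟩
    ℤ→ℚ (rightProfile Rℤ eℤ (ℤ.+ a) c (ℤ.+ k)) + ℤ→ℚ (rightVolume Rℤ eℤ (ℤ.+ (a ℕ.+ k)))
      ≡⟨ ℤ→ℚ-homo-+ (rightProfile Rℤ eℤ (ℤ.+ a) c (ℤ.+ k)) (rightVolume Rℤ eℤ (ℤ.+ (a ℕ.+ k))) ⟨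
    ℤ→ℚ (rightProfile Rℤ eℤ (ℤ.+ a) c (ℤ.+ k) ℤ.+ rightVolume Rℤ eℤ (ℤ.+ (a ℕ.+ k)))
      ≡⟨ cong ℤ→ℚ (Polynomial.rightProfile-step Rℤ eℤ (ℤ.+ a) c (ℤ.+ k)) ⟨
    ℤ→ℚ (rightProfile Rℤ eℤ (ℤ.+ a) c (ℤ.+ suc k))
      ∎
    where
    open ≡-Reasoning
    a+k<e : a ℕ.+ k ℕ.< e
    a+k<e = subst (ℕ._≤ e) (ℕ.+-suc a k) a+k+1≤e
    a<e : a ℕ.< e
    a<e = ℕ.≤-<-trans (ℕ.m≤m+n a k) a+k<e
    away′ : t ℕ.≤ a ℕ.+ k ⊎ p ℕ.≤ t
    away′ = Data.Sum.map₁ (λ t≤a → ℕ.≤-trans t≤a (ℕ.m≤m+n a k)) (proj₁ (clear a<e))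

  degree-star : e ≡ 0 → degree 0 ≡ ℕ→ℚ L + ℕ→ℚ R
  degree-star e≡0 = trans (neighbourSum-star (λ _ → 1ℚ) e≡0) (cong₂ _+_ (sumFrom-ones p L) (sumFrom-ones q R))

  degree-weighted-sum : ∀ g → sumFrom 0 n (λ j → degree j * g j)
    ≡ (ℕ→ℚ L - 1ℚ) * g 0 + (ℕ→ℚ R - 1ℚ) * g e + ℤ→ℚ (ℤ.+ 2) * sumFrom 0 p g + sumFrom p L g + sumFrom q R g
  degree-weighted-sum g = begin
    sumFrom 0 n wg                                              ≡⟨ cong (λ k → sumFrom 0 k wg) q+R≡n ⟨
    sumFrom 0 (p ℕ.+ L ℕ.+ R) wg                                ≡⟨ sumFrom-split 0 (p ℕ.+ L) R wg ⟩
    sumFrom 0 (p ℕ.+ L) wg + sumFrom q R wg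
      ≡⟨ cong (_+ sumFrom q R wg) (sumFrom-split 0 p L wg) ⟩
    sumFrom 0 p wg + sumFrom p L wg + sumFrom q R wg
      ≡⟨ cong₂ (λ x y → x + y + sumFrom q R wg) path left ⟩
    pathPart + sumFrom p L g + sumFrom q R wg
      ≡⟨ cong (pathPart + sumFrom p L g +_) right ⟩
    pathPart + sumFrom p L g + sumFrom q R g                    ∎
    where
    open ≡-Reasoning
    wg = λ j → degree j * g j
    pathPart = (ℕ→ℚ L - 1ℚ) * g 0 + (ℕ→ℚ R - 1ℚ) * g e + ℤ→ℚ (ℤ.+ 2) * sumFrom 0 p g
    path = path-weighted-sum e degree g (ℕ→ℚ L) (ℕ→ℚ R) degree-star
      (λ 0<e → trans (degree-first 0<e) (ℤ→ℚ-1+ Lℤ)) (λ i i+1≡e → trans (degree-last i i+1≡e) (ℤ→ℚ-1+ Rℤ))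
      (λ i i+2<p → degree-inner i i+2<p)
    left = sumFrom-cong p L λ j p≤j j<q → trans (cong (_* g j) (degree-leftLeaf j p≤j j<q)) (ℚ.*-identityˡ (g j))
    right = sumFrom-cong q R λ j q≤j _ → trans (cong (_* g j) (degree-rightLeaf j q≤j)) (ℚ.*-identityˡ (g j))

  -- Σ_u deg(u)·H(u, v) = 2|E|·H(π, v).
  degHit : ℚ
  degHit = sumFrom 0 n (λ j → degree j * h j)

  path-sum-profile : ∀ a j c → a ℕ.+ j ≡ e →
    (∀ i → i ℕ.≤ a → h i ≡ ℤ→ℚ (leftProfile Lℤ (ℤ.+ a) c (ℤ.+ i))) →
    (∀ k → a ℕ.+ k ℕ.≤ e → h (a ℕ.+ k) ≡ ℤ→ℚ (rightProfile Rℤ (ℤ.+ a ℤ.+ ℤ.+ j) (ℤ.+ a) c (ℤ.+ k))) →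
    sumFrom 0 p h ≡ ℤ→ℚ (ℤ-Sum.sumFrom 0 a (λ i → leftProfile Lℤ (ℤ.+ a) c (ℤ.+ i)))
                  + ℤ→ℚ (ℤ-Sum.sumFrom 0 (suc j) (λ k → rightProfile Rℤ (ℤ.+ a ℤ.+ ℤ.+ j) (ℤ.+ a) c (ℤ.+ k)))
  path-sum-profile a j c a+j≡e left right = begin
    sumFrom 0 p h
      ≡⟨ cong (λ k → sumFrom 0 k h) (trans (cong suc (sym a+j≡e)) (sym (ℕ.+-suc a j))) ⟩
    sumFrom 0 (a ℕ.+ suc j) h
      ≡⟨ sumFrom-split 0 a (suc j) h ⟩
    sumFrom 0 a h + sumFrom a (suc j) h
      ≡⟨ cong (sumFrom 0 a h +_) (sumFrom-shift a (suc j) h) ⟩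
    sumFrom 0 a h + sumFrom 0 (suc j) (λ k → h (a ℕ.+ k))
      ≡⟨ cong₂ _+_ (trans (sumFrom-cong 0 a λ i _ i<a → left i (ℕ.<⇒≤ i<a)) (sumFrom-ℤ→ℚ 0 a l))
                   (trans (sumFrom-cong 0 (suc j) λ k _ k≤j → right k (a+k≤e k≤j)) (sumFrom-ℤ→ℚ 0 (suc j) r)) ⟩
    ℤ→ℚ (ℤ-Sum.sumFrom 0 a l) + ℤ→ℚ (ℤ-Sum.sumFrom 0 (suc j) r)
      ∎
    where
    open ≡-Reasoning
    l = λ i → leftProfile Lℤ (ℤ.+ a) c (ℤ.+ i)
    r = λ k → rightProfile Rℤ (ℤ.+ a ℤ.+ ℤ.+ j) (ℤ.+ a) c (ℤ.+ k)
    a+k≤e : ∀ {k} → k ℕ.< 0 ℕ.+ suc j → a ℕ.+ k ℕ.≤ e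
    a+k≤e k<j+1 = subst (a ℕ.+ _ ℕ.≤_) a+j≡e (ℕ.+-monoʳ-≤ a (ℕ.s≤s⁻¹ k<j+1))

  degHit-profile : ∀ a j c εL εR → a ℕ.+ j ≡ e →
    (∀ i → i ℕ.≤ a → h i ≡ ℤ→ℚ (leftProfile Lℤ (ℤ.+ a) c (ℤ.+ i))) →
    (∀ k → a ℕ.+ k ℕ.≤ e → h (a ℕ.+ k) ≡ ℤ→ℚ (rightProfile Rℤ eℤ (ℤ.+ a) c (ℤ.+ k))) →
    sumFrom p L h ≡ ℤ→ℚ (Lℤ ℤ.- εL) * (1ℚ + h 0) →
    sumFrom q R h ≡ ℤ→ℚ (Rℤ ℤ.- εR) * (1ℚ + h e) →
    degHit ≡ ℤ→ℚ (Polynomial.weightedProfile Lℤ Rℤ c εL εR a j)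
  degHit-profile a j c εL εR a+j≡e left right leftLeaves rightLeaves = begin
    degHit
      ≡⟨ degree-weighted-sum h ⟩
    (ℕ→ℚ L - 1ℚ) * h 0 + (ℕ→ℚ R - 1ℚ) * h e + ℤ→ℚ (ℤ.+ 2) * sumFrom 0 p h + sumFrom p L h + sumFrom q R h
      ≡⟨ cong₂ _+_ (cong₂ _+_ (cong₂ _+_ (cong₂ _+_ (cong ((ℕ→ℚ L - 1ℚ) *_) h-first) (cong ((ℕ→ℚ R - 1ℚ) *_) h-last))
                                         (cong (ℤ→ℚ (ℤ.+ 2) *_) (path-sum-profile a j c a+j≡e left right′)))
                              (trans leftLeaves (cong (λ z → ℤ→ℚ (Lℤ ℤ.- εL) * (1ℚ + z)) h-first)))
                   (trans rightLeaves (cong (λ z → ℤ→ℚ (Rℤ ℤ.- εR) * (1ℚ + z)) h-last)) ⟩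
    (ℤ→ℚ Lℤ - 1ℚ) * ℤ→ℚ x + (ℤ→ℚ Rℤ - 1ℚ) * ℤ→ℚ y + ℤ→ℚ (ℤ.+ 2) * (ℤ→ℚ S₁ + ℤ→ℚ S₂)
      + ℤ→ℚ (Lℤ ℤ.- εL) * (1ℚ + ℤ→ℚ x) + ℤ→ℚ (Rℤ ℤ.- εR) * (1ℚ + ℤ→ℚ y)
      ≡⟨ ℤ→ℚ-weightedProfile Lℤ Rℤ εL εR x y S₁ S₂ ⟩
    ℤ→ℚ (Polynomial.weightedProfile Lℤ Rℤ c εL εR a j)
      ∎
    where
    open ≡-Reasoning
    e′ = ℤ.+ a ℤ.+ ℤ.+ j
    x = leftProfile Lℤ (ℤ.+ a) c (ℤ.+ 0)
    y = rightProfile Rℤ e′ (ℤ.+ a) c (ℤ.+ j)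
    S₁ = ℤ-Sum.sumFrom 0 a (λ i → leftProfile Lℤ (ℤ.+ a) c (ℤ.+ i))
    S₂ = ℤ-Sum.sumFrom 0 (suc j) (λ k → rightProfile Rℤ e′ (ℤ.+ a) c (ℤ.+ k))
    right′ : ∀ k → a ℕ.+ k ℕ.≤ e → h (a ℕ.+ k) ≡ ℤ→ℚ (rightProfile Rℤ e′ (ℤ.+ a) c (ℤ.+ k))
    right′ k a+k≤e = trans (right k a+k≤e)
      (cong (λ z → ℤ→ℚ (rightProfile Rℤ z (ℤ.+ a) c (ℤ.+ k))) (cong ℤ.+_ (sym a+j≡e)))
    h-first : h 0 ≡ ℤ→ℚ x
    h-first = left 0 ℕ.z≤n
    h-last : h e ≡ ℤ→ℚ y
    h-last = trans (cong h (sym a+j≡e)) (right′ j (ℕ.≤-reflexive a+j≡e))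

  anchorToLeaf : ℤ
  anchorToLeaf = ℤ.+ 2 ℤ.* edges ℤ.- ℤ.+ 1

  anchor-star : e ≡ 0 → 0 ≢ t → sumFrom p L h + sumFrom q R h ≡ (ℕ→ℚ L + ℕ→ℚ R - 1ℚ) * (1ℚ + h 0) →
                h 0 ≡ ℤ→ℚ anchorToLeaf
  anchor-star e≡0 0≢t leaves = trans
    (first-step-solve K K {y = 0ℚ}
      (vertex-balance 0 0<n 0≢t (ℤ.+ 1 ℤ.+ K) degree-0
        (trans (neighbourSum-star h e≡0) (sym (ℚ.+-identityˡ (sumFrom p L h + sumFrom q R h)))))
      (trans leaves (trans (cong (_* (1ℚ + h 0)) K≡) (*-1+ (ℤ→ℚ K) (h 0)))))
    (trans (ℚ.+-identityˡ (ℤ→ℚ (ℤ.+ 1 ℤ.+ K ℤ.+ K)))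
           (cong ℤ→ℚ (trans (Polynomial.leafTarget-star Lℤ Rℤ)
                            (cong (λ z → ℤ.+ 2 ℤ.* (ℤ.+ z ℤ.+ Lℤ ℤ.+ Rℤ) ℤ.- ℤ.+ 1) (sym e≡0)))))
    where
    K = Lℤ ℤ.+ Rℤ ℤ.- ℤ.+ 1
    K≡ : ℕ→ℚ L + ℕ→ℚ R - 1ℚ ≡ ℤ→ℚ K
    K≡ = sym (trans (ℤ→ℚ-homo-− (Lℤ ℤ.+ Rℤ) (ℤ.+ 1)) (cong (_- 1ℚ) (ℤ→ℚ-homo-+ Lℤ Rℤ)))
    degree-0 : degree 0 ≡ ℤ→ℚ (ℤ.+ 1 ℤ.+ K)
    degree-0 = trans (degree-star e≡0)
      (trans (sym (ℤ→ℚ-homo-+ Lℤ Rℤ)) (cong ℤ→ℚ (Polynomial.suc-pred (Lℤ ℤ.+ Rℤ))))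

  anchor-left : p ℕ.≤ t → t ℕ.< q → h 0 ≡ ℤ→ℚ anchorToLeaf
  anchor-left p≤t t<q = by-cases (e ℕ.≟ 0)
    where
    open +-*-Solver
    0≢t : 0 ≢ t
    0≢t 0≡t = ℕ.<⇒≱ (ℕ.<-≤-trans ℕ.z<s p≤t) (ℕ.≤-reflexive (sym 0≡t))
    merge : ∀ A B x → (A - 1ℚ) * x + B * x ≡ (A + B - 1ℚ) * x
    merge = solve 3 (λ A B x → (A :- con 1ℚ) :* x :+ B :* x := (A :+ B :- con 1ℚ) :* x) refl
    by-cases : Dec (e ≡ 0) → h 0 ≡ ℤ→ℚ anchorToLeaf
    by-cases (yes e≡0) = anchor-star e≡0 0≢t
      (trans (cong₂ _+_ (leftLeaves-sum-target p≤t t<q)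
                        (trans (rightLeaves-sum t<q) (cong (λ j → ℕ→ℚ R * (1ℚ + h j)) e≡0)))
             (merge (ℕ→ℚ L) (ℕ→ℚ R) (1ℚ + h 0)))
    by-cases (no e≢0) = trans
      (first-step-solve Lℤ (r ℤ.+ (Lℤ ℤ.- ℤ.+ 1)) {y = 0ℚ}
        (vertex-balance 0 0<n 0≢t (ℤ.+ 1 ℤ.+ Lℤ) (degree-first 0<e)
          (trans (neighbourSum-first h 0<e) (sym (ℚ.+-identityˡ (h 1 + sumFrom p L h)))))
        (trans (cong₂ _+_ (rightward (e ∸ 1) 0 (ℕ.m+[n∸m]≡n 0<e) (inj₂ p≤t) t<q)
                          (leftLeaves-sum-target p≤t t<q))
               (anchor-neighbours Lℤ r (h 0))))
      (trans (ℚ.+-identityˡ (ℤ→ℚ (ℤ.+ 1 ℤ.+ Lℤ ℤ.+ (r ℤ.+ (Lℤ ℤ.- ℤ.+ 1)))))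
             (cong ℤ→ℚ (Polynomial.leafTarget-first Lℤ Rℤ eℤ)))
      where
      r = rightVolume Rℤ eℤ (ℤ.+ 0)
      0<e = ℕ.n≢0⇒n>0 e≢0

  anchor-right : q ℕ.≤ t → h e ≡ ℤ→ℚ anchorToLeaf
  anchor-right q≤t = by-cases (e ℕ.≟ 0)
    where
    open +-*-Solver
    e<t : e ℕ.< t
    e<t = ℕ.<-≤-trans (ℕ.n<1+n e) (ℕ.≤-trans p≤q q≤t)
    merge : ∀ A B x → A * x + (B - 1ℚ) * x ≡ (A + B - 1ℚ) * x
    merge = solve 3 (λ A B x → A :* x :+ (B :- con 1ℚ) :* x := (A :+ B :- con 1ℚ) :* x) refl
    by-cases : Dec (e ≡ 0) → h e ≡ ℤ→ℚ anchorToLeaf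
    by-cases (yes e≡0) = trans (cong h e≡0) (anchor-star e≡0 (λ 0≡t → ℕ.<⇒≢ e<t (trans e≡0 0≡t))
      (trans (cong₂ _+_ (leftLeaves-sum (inj₂ q≤t))
                        (trans (rightLeaves-sum-target q≤t) (cong (λ j → (ℕ→ℚ R - 1ℚ) * (1ℚ + h j)) e≡0)))
             (merge (ℕ→ℚ L) (ℕ→ℚ R) (1ℚ + h 0))))
    by-cases (no e≢0) = subst (λ j → h j ≡ ℤ→ℚ anchorToLeaf) i+1≡e (trans
      (first-step-solve Rℤ (l ℤ.+ (Rℤ ℤ.- ℤ.+ 1)) {y = 0ℚ}
        (vertex-balance (suc i) (subst (ℕ._< n) (sym i+1≡e) e<n) (λ i+1≡t → ℕ.<⇒≢ e<t (trans (sym i+1≡e) i+1≡t))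
          (ℤ.+ 1 ℤ.+ Rℤ) (degree-last i i+1≡e)
          (trans (neighbourSum-last h i i+1≡e) (sym (ℚ.+-identityˡ (h i + sumFrom q R h)))))
        (trans (cong₂ _+_ (leftward i i<e (ℕ.<-trans i<e e<t) (inj₂ q≤t))
                          (trans (rightLeaves-sum-target q≤t) (cong (λ j → (ℕ→ℚ R - 1ℚ) * (1ℚ + h j)) (sym i+1≡e))))
               (anchor-neighbours Rℤ l (h (suc i)))))
      (trans (ℚ.+-identityˡ (ℤ→ℚ (ℤ.+ 1 ℤ.+ Rℤ ℤ.+ (l ℤ.+ (Rℤ ℤ.- ℤ.+ 1)))))
             (cong ℤ→ℚ (trans (Polynomial.leafTarget-last Lℤ Rℤ (ℤ.+ i))
                              (cong (λ z → ℤ.+ 2 ℤ.* (ℤ.+ z ℤ.+ Lℤ ℤ.+ Rℤ) ℤ.- ℤ.+ 1) i+1≡e)))))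
      where
      i = e ∸ 1
      i+1≡e : suc i ≡ e
      i+1≡e = ℕ.m+[n∸m]≡n (ℕ.n≢0⇒n>0 e≢0)
      i<e : i ℕ.< e
      i<e = ℕ.≤-reflexive i+1≡e
      l = leftVolume Lℤ (ℤ.+ i)

  profileValue : ℤ → ℤ → ℤ → ℕ → ℕ → ℤ
  profileValue = Polynomial.weightedProfile Lℤ Rℤ

  degHit-pathTarget : t ℕ.< p → degHit ≡ ℤ→ℚ (profileValue (ℤ.+ 0) (ℤ.+ 0) (ℤ.+ 0) t (e ∸ t))
  degHit-pathTarget t<p = degHit-profile t (e ∸ t) (ℤ.+ 0) (ℤ.+ 0) (ℤ.+ 0) (ℕ.m+[n∸m]≡n t≤e)
    (profile-left t (ℤ.+ 0) t≤e ℕ.≤-refl (λ _ → inj₁ t<p) h-target)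
    (profile-right t (ℤ.+ 0) (λ _ → inj₁ ℕ.≤-refl , t<q) h-target)
    (trans (leftLeaves-sum (inj₁ t<p)) (cong (λ z → ℤ→ℚ z * (1ℚ + h 0)) (sym (ℤ.+-identityʳ Lℤ))))
    (trans (rightLeaves-sum t<q) (cong (λ z → ℤ→ℚ z * (1ℚ + h e)) (sym (ℤ.+-identityʳ Rℤ))))
    where
    t≤e = ℕ.s≤s⁻¹ t<p
    t<q = ℕ.<-≤-trans t<p p≤q

  degHit-leftLeafTarget : p ℕ.≤ t → t ℕ.< q → degHit ≡ ℤ→ℚ (profileValue anchorToLeaf (ℤ.+ 1) (ℤ.+ 0) 0 e)
  degHit-leftLeafTarget p≤t t<q = degHit-profile 0 e anchorToLeaf (ℤ.+ 1) (ℤ.+ 0) refl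
    (profile-left 0 anchorToLeaf ℕ.z≤n ℕ.z≤n (λ ()) (anchor-left p≤t t<q))
    (profile-right 0 anchorToLeaf (λ _ → inj₂ p≤t , t<q) (anchor-left p≤t t<q))
    (trans (leftLeaves-sum-target p≤t t<q) (cong (_* (1ℚ + h 0)) (sym (ℤ→ℚ-homo-− Lℤ (ℤ.+ 1)))))
    (trans (rightLeaves-sum t<q) (cong (λ z → ℤ→ℚ z * (1ℚ + h e)) (sym (ℤ.+-identityʳ Rℤ))))

  degHit-rightLeafTarget : q ℕ.≤ t → degHit ≡ ℤ→ℚ (profileValue anchorToLeaf (ℤ.+ 0) (ℤ.+ 1) e 0)
  degHit-rightLeafTarget q≤t = degHit-profile e 0 anchorToLeaf (ℤ.+ 0) (ℤ.+ 1) (ℕ.+-identityʳ e)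
    (profile-left e anchorToLeaf ℕ.≤-refl e≤t (λ _ → inj₂ q≤t) (anchor-right q≤t))
    (profile-right e anchorToLeaf (λ e<e → ⊥-elim (ℕ.<-irrefl refl e<e)) (anchor-right q≤t))
    (trans (leftLeaves-sum (inj₂ q≤t)) (cong (λ z → ℤ→ℚ z * (1ℚ + h 0)) (sym (ℤ.+-identityʳ Lℤ))))
    (trans (rightLeaves-sum-target q≤t) (cong (_* (1ℚ + h e)) (sym (ℤ→ℚ-homo-− Rℤ (ℤ.+ 1)))))
    where
    e≤t = ℕ.≤-trans (ℕ.n≤1+n e) (ℕ.≤-trans p≤q q≤t)

  private
    times-six : ∀ w → degHit ≡ ℤ→ℚ w → ℤ→ℚ (ℤ.+ 6) * degHit ≡ ℤ→ℚ (ℤ.+ 6 ℤ.* w)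
    times-six w degHit≡w = trans (cong (ℤ→ℚ (ℤ.+ 6) *_) degHit≡w) (sym (ℤ→ℚ-homo-* (ℤ.+ 6) w))

  six-degHit-pathTarget : t ℕ.< p → ℤ→ℚ (ℤ.+ 6) * degHit ≡ ℤ→ℚ (Φ (ℤ.+ t))
  six-degHit-pathTarget t<p = trans (times-six (profileValue (ℤ.+ 0) (ℤ.+ 0) (ℤ.+ 0) t (e ∸ t)) (degHit-pathTarget t<p))
    (cong ℤ→ℚ (trans (Polynomial.six-weightedProfile Lℤ Rℤ (ℤ.+ 0) (ℤ.+ 0) (ℤ.+ 0) t (e ∸ t))
                     (trans (Polynomial.no-correction Φ′ Lℤ Rℤ (ℤ.+ t) (ℤ.+ (e ∸ t)))
                            (cong (λ z → Polynomial.Φ6 Lℤ Rℤ (ℤ.+ z) (ℤ.+ t)) (ℕ.m+[n∸m]≡n (ℕ.s≤s⁻¹ t<p))))))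
    where
    Φ′ = Polynomial.Φ6 Lℤ Rℤ (ℤ.+ (t ℕ.+ (e ∸ t))) (ℤ.+ t)

  six-degHit-leftLeafTarget : p ℕ.≤ t → t ℕ.< q →
    ℤ→ℚ (ℤ.+ 6) * degHit ≡ ℤ→ℚ (Φ (ℤ.+ 0) ℤ.+ ℤ.+ 24 ℤ.* edges ℤ.* (edges ℤ.- ℤ.+ 1))
  six-degHit-leftLeafTarget p≤t t<q =
    trans (times-six (profileValue anchorToLeaf (ℤ.+ 1) (ℤ.+ 0) 0 e) (degHit-leftLeafTarget p≤t t<q))
    (cong ℤ→ℚ (trans (Polynomial.six-weightedProfile Lℤ Rℤ anchorToLeaf (ℤ.+ 1) (ℤ.+ 0) 0 e)
                     (Polynomial.leftLeaf-correction (Φ (ℤ.+ 0)) eℤ Lℤ Rℤ)))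

  six-degHit-rightLeafTarget : q ℕ.≤ t →
    ℤ→ℚ (ℤ.+ 6) * degHit ≡ ℤ→ℚ (Φ eℤ ℤ.+ ℤ.+ 24 ℤ.* edges ℤ.* (edges ℤ.- ℤ.+ 1))
  six-degHit-rightLeafTarget q≤t =
    trans (times-six (profileValue anchorToLeaf (ℤ.+ 0) (ℤ.+ 1) e 0) (degHit-rightLeafTarget q≤t))
    (cong ℤ→ℚ (trans (Polynomial.six-weightedProfile Lℤ Rℤ anchorToLeaf (ℤ.+ 0) (ℤ.+ 1) e 0)
                     (trans (Polynomial.rightLeaf-correction Φ′ eℤ Lℤ Rℤ)
                            (cong (λ z → Polynomial.Φ6 Lℤ Rℤ (ℤ.+ z) eℤ ℤ.+ excess) (ℕ.+-identityʳ e)))))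
    where
    Φ′ = Polynomial.Φ6 Lℤ Rℤ (ℤ.+ (e ℕ.+ 0)) eℤ
    excess = ℤ.+ 24 ℤ.* edges ℤ.* (edges ℤ.- ℤ.+ 1)

  six-degHit-bound : ∀ B → (∀ x → B ℤ.≤ Φ x) → ℤ→ℚ B ≤ ℤ→ℚ (ℤ.+ 6) * degHit
  six-degHit-bound B B≤Φ = by-class (t ℕ.<? p) (t ℕ.<? q)
    where
    leaf-excess : ∀ x → x ℤ.≤ x ℤ.+ ℤ.+ 24 ℤ.* edges ℤ.* (edges ℤ.- ℤ.+ 1)
    leaf-excess x = Polynomial.0≤j⇒i≤i+j x (Polynomial.0≤24m[m-1] edges)
    by-class : Dec (t ℕ.< p) → Dec (t ℕ.< q) → ℤ→ℚ B ≤ ℤ→ℚ (ℤ.+ 6) * degHit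
    by-class (yes t<p) _ = subst (ℤ→ℚ B ≤_) (sym (six-degHit-pathTarget t<p)) (ℤ→ℚ-mono-≤ (B≤Φ (ℤ.+ t)))
    by-class (no t≮p) (yes t<q) = subst (ℤ→ℚ B ≤_) (sym (six-degHit-leftLeafTarget (ℕ.≮⇒≥ t≮p) t<q))
      (ℤ→ℚ-mono-≤ (ℤ.≤-trans (B≤Φ (ℤ.+ 0)) (leaf-excess (Φ (ℤ.+ 0)))))
    by-class (no _) (no t≮q) = subst (ℤ→ℚ B ≤_) (sym (six-degHit-rightLeafTarget (ℕ.≮⇒≥ t≮q)))
      (ℤ→ℚ-mono-≤ (ℤ.≤-trans (B≤Φ eℤ) (leaf-excess (Φ eℤ))))

  twoE-value : ℕ→ℚ (twoE (DoubleBroom n d)) ≡ ℤ→ℚ (ℤ.+ 2 ℤ.* edges)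
  twoE-value = begin
    ℕ→ℚ (twoE (DoubleBroom n d))
      ≡⟨ ℕ→ℚ-sumFinℕ n (deg (DoubleBroom n d)) ⟩
    sumFin n (λ u → ℕ→ℚ (deg (DoubleBroom n d) u))
      ≡⟨ sumFin-cong n (λ u → trans (ℕ→ℚ-deg u) (sym (ℚ.*-identityʳ (degree (toℕ u))))) ⟩
    sumFin n (λ u → degree (toℕ u) * 1ℚ)
      ≡⟨ sumFin-sumFrom n 0 (λ j → degree j * 1ℚ) ⟩
    sumFrom 0 n (λ j → degree j * 1ℚ)
      ≡⟨ degree-weighted-sum (λ _ → 1ℚ) ⟩
    (ℕ→ℚ L - 1ℚ) * 1ℚ + (ℕ→ℚ R - 1ℚ) * 1ℚ + ℤ→ℚ (ℤ.+ 2) * sumFrom 0 p (λ _ → 1ℚ)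
      + sumFrom p L (λ _ → 1ℚ) + sumFrom q R (λ _ → 1ℚ)
      ≡⟨ cong₂ _+_ (cong₂ _+_ (cong (λ z → (ℕ→ℚ L - 1ℚ) * 1ℚ + (ℕ→ℚ R - 1ℚ) * 1ℚ + ℤ→ℚ (ℤ.+ 2) * z)
                                     (trans (sumFrom-ones 0 p) (ℕ→ℚ-homo-+ 1 e)))
                              (sumFrom-ones p L))
                   (sumFrom-ones q R) ⟩
    (ℕ→ℚ L - 1ℚ) * 1ℚ + (ℕ→ℚ R - 1ℚ) * 1ℚ + ℤ→ℚ (ℤ.+ 2) * (1ℚ + ℕ→ℚ e) + ℕ→ℚ L + ℕ→ℚ R
      ≡⟨ count (ℕ→ℚ e) (ℕ→ℚ L) (ℕ→ℚ R) ⟩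
    ℤ→ℚ (ℤ.+ 2) * (ℕ→ℚ e + ℕ→ℚ L + ℕ→ℚ R)
      ≡⟨ cong (ℤ→ℚ (ℤ.+ 2) *_) (trans (ℤ→ℚ-homo-+ (eℤ ℤ.+ Lℤ) Rℤ) (cong (_+ ℕ→ℚ R) (ℤ→ℚ-homo-+ eℤ Lℤ))) ⟨
    ℤ→ℚ (ℤ.+ 2) * ℤ→ℚ edges
      ≡⟨ ℤ→ℚ-homo-* (ℤ.+ 2) edges ⟨
    ℤ→ℚ (ℤ.+ 2 ℤ.* edges)
      ∎
    where
    open ≡-Reasoning
    open +-*-Solver
    count : ∀ E L R → (L - 1ℚ) * 1ℚ + (R - 1ℚ) * 1ℚ + ℤ→ℚ (ℤ.+ 2) * (1ℚ + E) + L + R ≡ ℤ→ℚ (ℤ.+ 2) * (E + L + R)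
    count = solve 3 (λ E L R → (L :- con 1ℚ) :* con 1ℚ :+ (R :- con 1ℚ) :* con 1ℚ
                                :+ con (ℤ→ℚ (ℤ.+ 2)) :* (con 1ℚ :+ E) :+ L :+ R
                             := con (ℤ→ℚ (ℤ.+ 2)) :* (E :+ L :+ R)) refl

  Hπ-F : .{{_ : NonZero (twoE (DoubleBroom n d))}} → Hπ (DoubleBroom n d) H v ≡ ((ℤ.+ 1) / twoE (DoubleBroom n d)) * degHit
  Hπ-F = begin
    sumFin n (λ u → π G u * H u v)
      ≡⟨ sumFin-cong n weight-term ⟩
    sumFin n (λ u → w * (degree (toℕ u) * h (toℕ u)))
      ≡⟨ sumFin-sumFrom n 0 (λ j → w * (degree j * h j)) ⟩
    sumFrom 0 n (λ j → w * (degree j * h j))              ≡⟨ sumFrom-*ˡ 0 n w (λ j → degree j * h j) ⟩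
    w * degHit                                                 ∎
    where
    open ≡-Reasoning
    open +-*-Solver
    G = DoubleBroom n d
    w = (ℤ.+ 1) / twoE G
    regroup : ∀ a w b → a * w * b ≡ w * (a * b)
    regroup = solve 3 (λ a w b → a :* w :* b := w :* (a :* b)) refl
    weight-term : ∀ u → π G u * H u v ≡ w * (degree (toℕ u) * h (toℕ u))
    weight-term u = begin
      π G u * H u v                               ≡⟨ cong₂ _*_ (fraction-split (deg G u) (twoE G))
                                                                (sym (extend-toℕ (λ u′ → H u′ v) u)) ⟩
      ℕ→ℚ (deg G u) * w * h (toℕ u)               ≡⟨ cong (λ z → z * w * h (toℕ u)) (ℕ→ℚ-deg u) ⟩
      degree (toℕ u) * w * h (toℕ u)              ≡⟨ regroup (degree (toℕ u)) w (h (toℕ u)) ⟩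
      w * (degree (toℕ u) * h (toℕ u))            ∎

-- The closed form

half : ℚ
half = (ℤ.+ 1) / 2

formulaWith : ℚ → ℚ → ℚ → ℕ → ℕ → ℚ
formulaWith c e f k d =
  half * (((D - ℕ→ℚ 2) * N) - (D * D) + (ℕ→ℚ 3 * D) - c)
    + ((D * D * D) - (ℕ→ℚ 6 * D * D) + (e * D) - f) * ((ℤ.+ 1) / (6 ℕ.* suc k))
  where
  N = ℕ→ℚ (suc (suc k))
  D = ℕ→ℚ d

parityC parityE parityF : Bool → Bool → ℚ
parityC nOdd dOdd = if nOdd then (if dOdd then ℕ→ℚ 2 else ℕ→ℚ 1) else (if dOdd then 0ℚ else ℕ→ℚ 1)
parityE nOdd dOdd = if nOdd then (if dOdd then ℕ→ℚ 11 else ℕ→ℚ 8) else (if dOdd then ℕ→ℚ 8 else ℕ→ℚ 11)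
parityF nOdd dOdd = if nOdd then (if dOdd then ℕ→ℚ 6 else 0ℚ) else (if dOdd then 0ℚ else ℕ→ℚ 6)

formula-unfold : ∀ k d → let nOdd = (suc (suc k) ℕ.% 2) ℕ.≡ᵇ 1; dOdd = (d ℕ.% 2) ℕ.≡ᵇ 1 in
  formula (suc (suc k)) d ≡ formulaWith (parityC nOdd dOdd) (parityE nOdd dOdd) (parityF nOdd dOdd) k d
formula-unfold k d = refl

formulaWith-parity : ∀ ε δ → ε ℕ.≤ 1 → δ ℕ.≤ 1 → ∀ k d →
  let nOdd = (1 ℕ.+ ε) ℕ.% 2 ℕ.≡ᵇ 1; dOdd = (ε ℕ.+ δ) ℕ.% 2 ℕ.≡ᵇ 1 in
  formulaWith (parityC nOdd dOdd) (parityE nOdd dOdd) (parityF nOdd dOdd) k d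
    ≡ formulaWith (ℤ→ℚ (ℤ.+ 1 ℤ.+ ℤ.+ δ ℤ.- ℤ.+ ε)) (ℤ→ℚ (ℤ.+ 8 ℤ.+ ℤ.+ 3 ℤ.* ℤ.+ δ)) (ℤ→ℚ (ℤ.+ 6 ℤ.* ℤ.+ δ)) k d
formulaWith-parity 0 0 _ _ k d = refl
formulaWith-parity 0 1 _ _ k d = refl
formulaWith-parity 1 0 _ _ k d = refl
formulaWith-parity 1 1 _ _ k d = refl
formulaWith-parity (suc (suc _)) _ (ℕ.s≤s ()) _
formulaWith-parity _ (suc (suc _)) _ (ℕ.s≤s ())

formulaWith-ℤ : ∀ c e f k d → let N = ℤ.+ suc (suc k); D = ℤ.+ d in
  formulaWith (ℤ→ℚ c) (ℤ→ℚ e) (ℤ→ℚ f) k d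
    ≡ half * ℤ→ℚ (Polynomial.formulaX N D c) + ℤ→ℚ (Polynomial.formulaY D e f) * ((ℤ.+ 1) / (6 ℕ.* suc k))
formulaWith-ℤ c e f k d = sym (cong₂ (λ x y → half * x + y * ((ℤ.+ 1) / (6 ℕ.* suc k))) pushX pushY)
  where
  open ≡-Reasoning
  N = ℤ.+ suc (suc k)
  D = ℤ.+ d
  n′ = ℤ→ℚ N
  d′ = ℤ→ℚ D
  pushX : ℤ→ℚ ((D ℤ.- ℤ.+ 2) ℤ.* N ℤ.- D ℤ.* D ℤ.+ ℤ.+ 3 ℤ.* D ℤ.- c)
        ≡ ((d′ - ℤ→ℚ (ℤ.+ 2)) * n′) - (d′ * d′) + (ℤ→ℚ (ℤ.+ 3) * d′) - ℤ→ℚ c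
  pushX = begin
    ℤ→ℚ ((D ℤ.- ℤ.+ 2) ℤ.* N ℤ.- D ℤ.* D ℤ.+ ℤ.+ 3 ℤ.* D ℤ.- c)
      ≡⟨ ℤ→ℚ-homo-− ((D ℤ.- ℤ.+ 2) ℤ.* N ℤ.- D ℤ.* D ℤ.+ ℤ.+ 3 ℤ.* D) c ⟩
    ℤ→ℚ ((D ℤ.- ℤ.+ 2) ℤ.* N ℤ.- D ℤ.* D ℤ.+ ℤ.+ 3 ℤ.* D) - ℤ→ℚ c
      ≡⟨ cong (_- ℤ→ℚ c) (ℤ→ℚ-homo-+ ((D ℤ.- ℤ.+ 2) ℤ.* N ℤ.- D ℤ.* D) (ℤ.+ 3 ℤ.* D)) ⟩
    ℤ→ℚ ((D ℤ.- ℤ.+ 2) ℤ.* N ℤ.- D ℤ.* D) + ℤ→ℚ (ℤ.+ 3 ℤ.* D) - ℤ→ℚ c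
      ≡⟨ cong₂ (λ x y → x + y - ℤ→ℚ c) (ℤ→ℚ-homo-− ((D ℤ.- ℤ.+ 2) ℤ.* N) (D ℤ.* D)) (ℤ→ℚ-homo-* (ℤ.+ 3) D) ⟩
    ℤ→ℚ ((D ℤ.- ℤ.+ 2) ℤ.* N) - ℤ→ℚ (D ℤ.* D) + (ℤ→ℚ (ℤ.+ 3) * d′) - ℤ→ℚ c
      ≡⟨ cong₂ (λ x y → x - y + (ℤ→ℚ (ℤ.+ 3) * d′) - ℤ→ℚ c)
               (trans (ℤ→ℚ-homo-* (D ℤ.- ℤ.+ 2) N) (cong (_* n′) (ℤ→ℚ-homo-− D (ℤ.+ 2))))
               (ℤ→ℚ-homo-* D D) ⟩
    ((d′ - ℤ→ℚ (ℤ.+ 2)) * n′) - (d′ * d′) + (ℤ→ℚ (ℤ.+ 3) * d′) - ℤ→ℚ c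
      ∎
  pushY : ℤ→ℚ (D ℤ.* D ℤ.* D ℤ.- ℤ.+ 6 ℤ.* D ℤ.* D ℤ.+ e ℤ.* D ℤ.- f)
        ≡ (d′ * d′ * d′) - (ℤ→ℚ (ℤ.+ 6) * d′ * d′) + (ℤ→ℚ e * d′) - ℤ→ℚ f
  pushY = begin
    ℤ→ℚ (D ℤ.* D ℤ.* D ℤ.- ℤ.+ 6 ℤ.* D ℤ.* D ℤ.+ e ℤ.* D ℤ.- f)
      ≡⟨ ℤ→ℚ-homo-− (D ℤ.* D ℤ.* D ℤ.- ℤ.+ 6 ℤ.* D ℤ.* D ℤ.+ e ℤ.* D) f ⟩
    ℤ→ℚ (D ℤ.* D ℤ.* D ℤ.- ℤ.+ 6 ℤ.* D ℤ.* D ℤ.+ e ℤ.* D) - ℤ→ℚ f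
      ≡⟨ cong (_- ℤ→ℚ f) (ℤ→ℚ-homo-+ (D ℤ.* D ℤ.* D ℤ.- ℤ.+ 6 ℤ.* D ℤ.* D) (e ℤ.* D)) ⟩
    ℤ→ℚ (D ℤ.* D ℤ.* D ℤ.- ℤ.+ 6 ℤ.* D ℤ.* D) + ℤ→ℚ (e ℤ.* D) - ℤ→ℚ f
      ≡⟨ cong₂ (λ x y → x + y - ℤ→ℚ f) (ℤ→ℚ-homo-− (D ℤ.* D ℤ.* D) (ℤ.+ 6 ℤ.* D ℤ.* D)) (ℤ→ℚ-homo-* e D) ⟩
    ℤ→ℚ (D ℤ.* D ℤ.* D) - ℤ→ℚ (ℤ.+ 6 ℤ.* D ℤ.* D) + (ℤ→ℚ e * d′) - ℤ→ℚ f
      ≡⟨ cong₂ (λ x y → x - y + (ℤ→ℚ e * d′) - ℤ→ℚ f) (cube D D) (cube (ℤ.+ 6) D) ⟩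
    (d′ * d′ * d′) - (ℤ→ℚ (ℤ.+ 6) * d′ * d′) + (ℤ→ℚ e * d′) - ℤ→ℚ f
      ∎
    where
    cube : ∀ a b → ℤ→ℚ (a ℤ.* b ℤ.* b) ≡ ℤ→ℚ a * ℤ→ℚ b * ℤ→ℚ b
    cube a b = trans (ℤ→ℚ-homo-* (a ℤ.* b) b) (cong (_* ℤ→ℚ b) (ℤ→ℚ-homo-* a b))

best-value : ∀ (m X Y : ℤ) (F w₂ w₆ : ℚ) →
  ℤ→ℚ (ℤ.+ 2 ℤ.* m) * w₂ ≡ 1ℚ → ℤ→ℚ (ℤ.+ 6 ℤ.* m) * w₆ ≡ 1ℚ →
  ℤ→ℚ (ℤ.+ 6) * F ≡ ℤ→ℚ (ℤ.+ 2 ℤ.* (ℤ.+ 3 ℤ.* m ℤ.* X ℤ.+ Y)) → w₂ * F ≡ half * ℤ→ℚ X + ℤ→ℚ Y * w₆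
best-value m X Y F w₂ w₆ 2mw₂≡1 6mw₆≡1 6F≡ = begin
  w₂ * F
    ≡⟨ ℚ.*-identityʳ (w₂ * F) ⟨
  w₂ * F * 1ℚ
    ≡⟨ cong (w₂ * F *_) 6Mw₆≡1 ⟨
  w₂ * F * (ℤ→ℚ (ℤ.+ 6) * M * w₆)
    ≡⟨ regroup₁ w₂ F M w₆ ⟩
  (ℤ→ℚ (ℤ.+ 2) * M * w₂) * (ℤ→ℚ (ℤ.+ 6) * F) * w₆ * half
    ≡⟨ cong₂ (λ x y → x * y * w₆ * half) 2Mw₂≡1 (trans 6F≡ pushF) ⟩
  1ℚ * (ℤ→ℚ (ℤ.+ 2) * (ℤ→ℚ (ℤ.+ 3) * M * ℤ→ℚ X + ℤ→ℚ Y)) * w₆ * half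
    ≡⟨ regroup₂ M (ℤ→ℚ X) (ℤ→ℚ Y) w₆ ⟩
  half * ℤ→ℚ X * (ℤ→ℚ (ℤ.+ 6) * M * w₆) + ℤ→ℚ Y * w₆
    ≡⟨ cong (λ z → half * ℤ→ℚ X * z + ℤ→ℚ Y * w₆) 6Mw₆≡1 ⟩
  half * ℤ→ℚ X * 1ℚ + ℤ→ℚ Y * w₆
    ≡⟨ cong (_+ ℤ→ℚ Y * w₆) (ℚ.*-identityʳ (half * ℤ→ℚ X)) ⟩
  half * ℤ→ℚ X + ℤ→ℚ Y * w₆
    ∎
  where
  open ≡-Reasoning
  open +-*-Solver
  M = ℤ→ℚ m
  2Mw₂≡1 : ℤ→ℚ (ℤ.+ 2) * M * w₂ ≡ 1ℚ
  2Mw₂≡1 = trans (cong (_* w₂) (sym (ℤ→ℚ-homo-* (ℤ.+ 2) m))) 2mw₂≡1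
  6Mw₆≡1 : ℤ→ℚ (ℤ.+ 6) * M * w₆ ≡ 1ℚ
  6Mw₆≡1 = trans (cong (_* w₆) (sym (ℤ→ℚ-homo-* (ℤ.+ 6) m))) 6mw₆≡1
  pushF : ℤ→ℚ (ℤ.+ 2 ℤ.* (ℤ.+ 3 ℤ.* m ℤ.* X ℤ.+ Y)) ≡ ℤ→ℚ (ℤ.+ 2) * (ℤ→ℚ (ℤ.+ 3) * M * ℤ→ℚ X + ℤ→ℚ Y)
  pushF = trans (ℤ→ℚ-homo-* (ℤ.+ 2) (ℤ.+ 3 ℤ.* m ℤ.* X ℤ.+ Y))
    (cong (ℤ→ℚ (ℤ.+ 2) *_) (trans (ℤ→ℚ-homo-+ (ℤ.+ 3 ℤ.* m ℤ.* X) Y)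
      (cong (_+ ℤ→ℚ Y) (trans (ℤ→ℚ-homo-* (ℤ.+ 3 ℤ.* m) X) (cong (_* ℤ→ℚ X) (ℤ→ℚ-homo-* (ℤ.+ 3) m))))))
  regroup₁ : ∀ w F M z → w * F * (ℤ→ℚ (ℤ.+ 6) * M * z) ≡ (ℤ→ℚ (ℤ.+ 2) * M * w) * (ℤ→ℚ (ℤ.+ 6) * F) * z * half
  regroup₁ = solve 4 (λ w F M z → w :* F :* (con (ℤ→ℚ (ℤ.+ 6)) :* M :* z)
                               := (con (ℤ→ℚ (ℤ.+ 2)) :* M :* w) :* (con (ℤ→ℚ (ℤ.+ 6)) :* F) :* z :* con half) refl
  regroup₂ : ∀ M X Y z → 1ℚ * (ℤ→ℚ (ℤ.+ 2) * (ℤ→ℚ (ℤ.+ 3) * M * X + Y)) * z * half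
                         ≡ half * X * (ℤ→ℚ (ℤ.+ 6) * M * z) + Y * z
  regroup₂ = solve 4 (λ M X Y z → con 1ℚ :* (con (ℤ→ℚ (ℤ.+ 2)) :* (con (ℤ→ℚ (ℤ.+ 3)) :* M :* X :+ Y)) :* z :* con half
                               := con half :* X :* (con (ℤ→ℚ (ℤ.+ 6)) :* M :* z) :+ Y :* z) refl

-- The best meeting vertex

halving-bound : ∀ a b → a ℕ.* 2 ℕ.≤ suc b → a ℕ.≤ b
halving-bound zero    b _ = ℕ.z≤n
halving-bound (suc a) b 2a+2≤b+1 = ℕ.≤-trans (ℕ.s≤s (ℕ.m≤m*n a 2)) (ℕ.s≤s⁻¹ 2a+2≤b+1)

module Optimum (k e : ℕ) (3+e≤n : 3 ℕ.+ e ℕ.≤ suc (suc k)) (H : Fin (suc (suc k)) → Fin (suc (suc k)) → ℚ)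
               (hit : IsHittingTime (DoubleBroom (suc (suc k)) (suc (suc e))) H) where
  open import Data.Nat.Tactic.RingSolver using (solve-∀)

  n : ℕ
  n = suc (suc k)

  open Broom n e 3+e≤n
  module At = Walk n e 3+e≤n H hit

  δ ε ks : ℕ
  δ  = (n ∸ p) ℕ.% 2
  ε  = (e ℕ.+ δ) ℕ.% 2
  ks = (e ℕ.+ δ) ℕ./ 2

  δ≤1 : δ ℕ.≤ 1
  δ≤1 = ℕ.s≤s⁻¹ (ℕ.m%n<n (n ∸ p) 2)

  ε≤1 : ε ℕ.≤ 1
  ε≤1 = ℕ.s≤s⁻¹ (ℕ.m%n<n (e ℕ.+ δ) 2)

  n≡ : n ≡ p ℕ.+ (δ ℕ.+ L ℕ.* 2)
  n≡ = trans (sym (ℕ.m+[n∸m]≡n p≤n)) (cong (p ℕ.+_) (ℕ.m≡m%n+[m/n]*n (n ∸ p) 2))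

  e+δ≡ : e ℕ.+ δ ≡ ε ℕ.+ ks ℕ.* 2
  e+δ≡ = ℕ.m≡m%n+[m/n]*n (e ℕ.+ δ) 2

  R≡L+δ : R ≡ L ℕ.+ δ
  R≡L+δ = begin
    n ∸ q                                         ≡⟨ cong (_∸ q) n≡ ⟩
    p ℕ.+ (δ ℕ.+ L ℕ.* 2) ∸ q                     ≡⟨ cong (_∸ q) (split p L δ) ⟩
    q ℕ.+ (L ℕ.+ δ) ∸ q                           ≡⟨ ℕ.m+n∸m≡n q (L ℕ.+ δ) ⟩
    L ℕ.+ δ                                       ∎
    where
    open ≡-Reasoning
    split : ∀ p L δ → p ℕ.+ (δ ℕ.+ L ℕ.* 2) ≡ p ℕ.+ L ℕ.+ (L ℕ.+ δ)
    split = solve-∀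

  n≡m+1 : n ≡ e ℕ.+ L ℕ.+ R ℕ.+ 1
  n≡m+1 = trans (sym q+R≡n) (shift-one e L R)
    where
    q+R≡n : q ℕ.+ R ≡ n
    q+R≡n = ℕ.m+[n∸m]≡n q≤n
    shift-one : ∀ e L R → suc e ℕ.+ L ℕ.+ R ≡ e ℕ.+ L ℕ.+ R ℕ.+ 1
    shift-one = solve-∀

  ks≤e : ks ℕ.≤ e
  ks≤e = halving-bound ks e (begin
    ks ℕ.* 2          ≤⟨ ℕ.m≤n+m (ks ℕ.* 2) ε ⟩
    ε ℕ.+ ks ℕ.* 2    ≡⟨ e+δ≡ ⟨
    e ℕ.+ δ           ≤⟨ ℕ.+-monoʳ-≤ e δ≤1 ⟩
    e ℕ.+ 1           ≡⟨ ℕ.+-comm e 1 ⟩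
    suc e             ∎)
    where open ℕ.≤-Reasoning

  ks<n : ks ℕ.< n
  ks<n = ℕ.<-≤-trans (ℕ.s≤s ks≤e) p≤n

  best : Fin n
  best = Fin.fromℕ< ks<n

  Rℤ≡ : Rℤ ≡ Lℤ ℤ.+ ℤ.+ δ
  Rℤ≡ = cong ℤ.+_ R≡L+δ

  eℤ≡ : eℤ ≡ ℤ.+ 2 ℤ.* ℤ.+ ks ℤ.+ ℤ.+ ε ℤ.- ℤ.+ δ
  eℤ≡ = Polynomial.solve-for-e eℤ (ℤ.+ δ) (ℤ.+ ε) (ℤ.+ ks)
          (trans (cong ℤ.+_ e+δ≡) (cong (λ x → ℤ.+ ε ℤ.+ x) (ℤ.pos-* ks 2)))

  Φ-minimal : ∀ x → Φ (ℤ.+ ks) ℤ.≤ Φ x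
  Φ-minimal x = Polynomial.Φ6-minimum Lℤ Rℤ eℤ (ℤ.+ δ) (ℤ.+ ks) ε x ε≤1 (ℤ.+≤+ ℕ.z≤n) Rℤ≡ eℤ≡

  N D X Y : ℤ
  N = ℤ.+ n
  D = ℤ.+ d
  X = Polynomial.formulaX N D (ℤ.+ 1 ℤ.+ ℤ.+ δ ℤ.- ℤ.+ ε)
  Y = Polynomial.formulaY D (ℤ.+ 8 ℤ.+ ℤ.+ 3 ℤ.* ℤ.+ δ) (ℤ.+ 6 ℤ.* ℤ.+ δ)

  Φ-at-best : Φ (ℤ.+ ks) ≡ ℤ.+ 2 ℤ.* (ℤ.+ 3 ℤ.* (N ℤ.- ℤ.+ 1) ℤ.* X ℤ.+ Y)
  Φ-at-best = Polynomial.Φ6-optimum ε δ ε≤1 δ≤1 Lℤ Rℤ eℤ (ℤ.+ ks) N D Rℤ≡ eℤ≡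
    (cong ℤ.+_ (ℕ.+-comm 2 e)) (cong ℤ.+_ n≡m+1)

  nOdd : (n ℕ.% 2 ℕ.≡ᵇ 1) ≡ ((1 ℕ.+ ε) ℕ.% 2 ℕ.≡ᵇ 1)
  nOdd = cong (ℕ._≡ᵇ 1) (trans (cong (ℕ._% 2) n≡′) (ℕ.[m+kn]%n≡m%n (1 ℕ.+ ε) (ks ℕ.+ L) 2))
    where
    regroup : ∀ e δ L → suc e ℕ.+ (δ ℕ.+ L ℕ.* 2) ≡ suc (e ℕ.+ δ) ℕ.+ L ℕ.* 2
    regroup = solve-∀
    regroup′ : ∀ ε ks L → suc (ε ℕ.+ ks ℕ.* 2) ℕ.+ L ℕ.* 2 ≡ 1 ℕ.+ ε ℕ.+ (ks ℕ.+ L) ℕ.* 2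
    regroup′ = solve-∀
    n≡′ : n ≡ 1 ℕ.+ ε ℕ.+ (ks ℕ.+ L) ℕ.* 2
    n≡′ = trans n≡ (trans (regroup e δ L) (trans (cong (λ x → suc x ℕ.+ L ℕ.* 2) e+δ≡) (regroup′ ε ks L)))

  dOdd : (d ℕ.% 2 ℕ.≡ᵇ 1) ≡ ((ε ℕ.+ δ) ℕ.% 2 ℕ.≡ᵇ 1)
  dOdd = cong (ℕ._≡ᵇ 1) (begin
    d ℕ.% 2                                  ≡⟨ ℕ.[m+kn]%n≡m%n d δ 2 ⟨
    (d ℕ.+ δ ℕ.* 2) ℕ.% 2                    ≡⟨ cong (ℕ._% 2) d+2δ≡ ⟩
    (ε ℕ.+ δ ℕ.+ (1 ℕ.+ ks) ℕ.* 2) ℕ.% 2     ≡⟨ ℕ.[m+kn]%n≡m%n (ε ℕ.+ δ) (1 ℕ.+ ks) 2 ⟩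
    (ε ℕ.+ δ) ℕ.% 2                          ∎)
    where
    open ≡-Reasoning
    regroup : ∀ e δ → suc (suc e) ℕ.+ δ ℕ.* 2 ≡ suc (suc (e ℕ.+ δ)) ℕ.+ δ
    regroup = solve-∀
    regroup′ : ∀ ε ks δ → suc (suc (ε ℕ.+ ks ℕ.* 2)) ℕ.+ δ ≡ ε ℕ.+ δ ℕ.+ (1 ℕ.+ ks) ℕ.* 2
    regroup′ = solve-∀
    d+2δ≡ : d ℕ.+ δ ℕ.* 2 ≡ ε ℕ.+ δ ℕ.+ (1 ℕ.+ ks) ℕ.* 2
    d+2δ≡ = trans (regroup e δ) (trans (cong (λ x → suc (suc x) ℕ.+ δ) e+δ≡) (regroup′ ε ks δ))

  six-degHit-best : ℤ→ℚ (ℤ.+ 6) * At.degHit best ≡ ℤ→ℚ (Φ (ℤ.+ ks))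
  six-degHit-best = trans (At.six-degHit-pathTarget best best<p) (cong (λ j → ℤ→ℚ (Φ (ℤ.+ j))) (Fin.toℕ-fromℕ< ks<n))
    where
    best<p : toℕ best ℕ.< p
    best<p = subst (ℕ._< p) (sym (Fin.toℕ-fromℕ< ks<n)) (ℕ.s≤s ks≤e)

  module _ .{{_ : NonZero (twoE (DoubleBroom n d))}} where
    G : Adj n
    G = DoubleBroom n d

    w₂ w₆ : ℚ
    w₂ = (ℤ.+ 1) / twoE G
    w₆ = (ℤ.+ 1) / (6 ℕ.* suc k)

    edges≡ : edges ≡ ℤ.+ suc k
    edges≡ = cong ℤ.+_ (ℕ.suc-injective (trans (ℕ.+-comm 1 (e ℕ.+ L ℕ.+ R)) (sym n≡m+1)))

    2mw₂≡1 : ℤ→ℚ (ℤ.+ 2 ℤ.* ℤ.+ suc k) * w₂ ≡ 1ℚ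
    2mw₂≡1 = trans (cong (λ z → ℤ→ℚ (ℤ.+ 2 ℤ.* z) * w₂) (sym edges≡))
                   (trans (cong (_* w₂) (sym (At.twoE-value best))) (*-reciprocal (twoE G)))

    6mw₆≡1 : ℤ→ℚ (ℤ.+ 6 ℤ.* ℤ.+ suc k) * w₆ ≡ 1ℚ
    6mw₆≡1 = trans (cong (λ z → ℤ→ℚ z * w₆) (sym (ℤ.pos-* 6 (suc k)))) (*-reciprocal (6 ℕ.* suc k))

    value : Hπ G H best ≡ formula n d
    value = begin
      Hπ G H best
        ≡⟨ At.Hπ-F best ⟩
      w₂ * At.degHit best
        ≡⟨ best-value (ℤ.+ suc k) X Y (At.degHit best) w₂ w₆ 2mw₂≡1 6mw₆≡1
                      (trans six-degHit-best (cong ℤ→ℚ Φ-at-best)) ⟩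
      half * ℤ→ℚ X + ℤ→ℚ Y * w₆
        ≡⟨ formulaWith-ℤ c e′ f k d ⟨
      formulaWith (ℤ→ℚ c) (ℤ→ℚ e′) (ℤ→ℚ f) k d
        ≡⟨ formulaWith-parity ε δ ε≤1 δ≤1 k d ⟨
      formulaWith (parityC b₁ b₂) (parityE b₁ b₂) (parityF b₁ b₂) k d
        ≡⟨ cong₂ (λ x y → formulaWith (parityC x y) (parityE x y) (parityF x y) k d) nOdd dOdd ⟨
      formulaWith (parityC nO dO) (parityE nO dO) (parityF nO dO) k d
        ≡⟨ formula-unfold k d ⟨
      formula n d
        ∎
      where
      open ≡-Reasoning
      c  = ℤ.+ 1 ℤ.+ ℤ.+ δ ℤ.- ℤ.+ ε
      e′ = ℤ.+ 8 ℤ.+ ℤ.+ 3 ℤ.* ℤ.+ δ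
      f  = ℤ.+ 6 ℤ.* ℤ.+ δ
      b₁ = (1 ℕ.+ ε) ℕ.% 2 ℕ.≡ᵇ 1
      b₂ = (ε ℕ.+ δ) ℕ.% 2 ℕ.≡ᵇ 1
      nO = n ℕ.% 2 ℕ.≡ᵇ 1
      dO = d ℕ.% 2 ℕ.≡ᵇ 1

    minimal : ∀ v → formula n d ≤ Hπ G H v
    minimal v = begin
      formula n d          ≡⟨ value ⟨
      Hπ G H best          ≡⟨ At.Hπ-F best ⟩
      w₂ * At.degHit best  ≤⟨ ℚ.*-monoˡ-≤-nonNeg w₂ {{ℚ.normalize-nonNeg 1 (twoE G)}} degHit-best≤degHit-v ⟩
      w₂ * At.degHit v     ≡⟨ At.Hπ-F v ⟨
      Hπ G H v             ∎
      where
      open ℚ.≤-Reasoning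
      degHit-best≤degHit-v : At.degHit best ≤ At.degHit v
      degHit-best≤degHit-v = ℚ.*-cancelˡ-≤-pos (ℤ→ℚ (ℤ.+ 6))
        (ℚ.≤-trans (ℚ.≤-reflexive six-degHit-best) (At.six-degHit-bound v (Φ (ℤ.+ ks)) Φ-minimal))

    best-meet : IsBestMeet G H (formula n d)
    best-meet = (best , value) , minimal

corollary4p5 : (n d : ℕ) → 2 ℕ.≤ d → d ℕ.≤ n ∸ 1 →
    .{{_ : NonZero (twoE (DoubleBroom n d))}} →
    (H : Fin n → Fin n → ℚ) → IsHittingTime (DoubleBroom n d) H →
    IsBestMeet (DoubleBroom n d) H (formula n d)
corollary4p5 _             (suc zero)    (ℕ.s≤s ()) _
corollary4p5 zero          (suc (suc e)) _          ()
corollary4p5 (suc zero)    (suc (suc e)) _          ()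
corollary4p5 (suc (suc k)) (suc (suc e)) _          d≤n-1 H hit = Optimum.best-meet k e (ℕ.s≤s d≤n-1) H hit
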